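{- For HyLL (as described in the context), for all $\Gamma,\Delta,C,w$: (1) (soundness) if $\Gamma;\Delta\Longrightarrow C@w$ is derivable in the sequent calculus, then $\Gamma;\Delta\vdash C@w$ is derivable in natural deduction; (2) (completeness) if $\Gamma;\Delta\vdash C@w$ is derivable in natural deduction, then $\Gamma;\Delta\Longrightarrow C@w$ is derivable in the sequent calculus.
   Context: Fix a constraint domain, i.e. a monoid $\mathcal W=\langle W,\cdot,\iota\rangle$ whose elements are called worlds. World expressions $u,v,w$ are built from world variables and elements of $W$ using $\cdot$; terms are built from term variables and function symbols. HyLL propositions are $A,B::= a\,\vec t \mid A\otimes B\mid \mathbf 1\mid A\multimap B\mid A\,\&\,B\mid\top\mid A\oplus B\mid \mathbf 0\mid\, !A\mid \forall x.A\mid\exists x.A\mid (A\ \mathrm{at}\ w)\mid \downarrow u.A\mid\forall u.A\mid \exists u.A$, with $a$ a predicate symbol applied to terms, $x$ a term variable, $u$ a world variable ($\downarrow u$, $\forall u$, $\exists u$ bind $u$). $\alpha$ ranges over variables of either kind, $\tau$ over terms or world expressions accordingly, $[\tau/\alpha]A$ is capture-avoiding substitution, and propositions are identified up to $\alpha$-conversion. A judgement is $A@w$; $\Gamma$ denotes a set (unrestricted context) and $\Delta$ a multiset (linear context) of judgements. Sequent calculus: sequents $\Gamma;\Delta\Longrightarrow C@w$ generated by: init: $\Gamma;a\,\vec t@u\Longrightarrow a\,\vec t@u$; copy: from $\Gamma,A@u;\Delta,A@u\Longrightarrow C@w$ infer $\Gamma,A@u;\Delta\Longrightarrow C@w$;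 $\otimes$R: from $\Gamma;\Delta\Longrightarrow A@w$, $\Gamma;\Delta'\Longrightarrow B@w$ infer $\Gamma;\Delta,\Delta'\Longrightarrow A\otimes B@w$; $\otimes$L: from $\Gamma;\Delta,A@u,B@u\Longrightarrow C@w$ infer $\Gamma;\Delta,A\otimes B@u\Longrightarrow C@w$; $\mathbf1$R: $\Gamma;\cdot\Longrightarrow\mathbf1@w$; $\mathbf1$L: from $\Gamma;\Delta\Longrightarrow C@w$ infer $\Gamma;\Delta,\mathbf1@u\Longrightarrow C@w$; $\multimap$R: from $\Gamma;\Delta,A@w\Longrightarrow B@w$ infer $\Gamma;\Delta\Longrightarrow A\multimap B@w$; $\multimap$L: from $\Gamma;\Delta\Longrightarrow A@u$, $\Gamma;\Delta',B@u\Longrightarrow C@w$ infer $\Gamma;\Delta,\Delta',A\multimap B@u\Longrightarrow C@w$; $\top$R: $\Gamma;\Delta\Longrightarrow\top@w$; $\&$R: from $\Gamma;\Delta\Longrightarrow A@w$, $\Gamma;\Delta\Longrightarrow B@w$ infer $\Gamma;\Delta\Longrightarrow A\&B@w$; $\&$L$_i$: from $\Gamma;\Delta,A_i@u\Longrightarrow C@w$ infer $\Gamma;\Delta,A_1\&A_2@u\Longrightarrow C@w$; $\oplus$R$_i$: from $\Gamma;\Delta\Longrightarrow A_i@w$ infer $\Gamma;\Delta\Longrightarrow A_1\oplus A_2@w$; $\oplus$L: from $\Gamma;\Delta,A@u\Longrightarrow C@w$, $\Gamma;\Delta,B@u\Longrightarrow C@w$ infer $\Gamma;\Delta,A\oplus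 B@u\Longrightarrow C@w$; $\mathbf0$L: $\Gamma;\Delta,\mathbf0@u\Longrightarrow C@w$; $\forall$R: from $\Gamma;\Delta\Longrightarrow A@w$ infer $\Gamma;\Delta\Longrightarrow\forall\alpha.A@w$ ($\alpha$ fresh); $\forall$L: from $\Gamma;\Delta,[\tau/\alpha]A@u\Longrightarrow C@w$ infer $\Gamma;\Delta,\forall\alpha.A@u\Longrightarrow C@w$; $\exists$R: from $\Gamma;\Delta\Longrightarrow[\tau/\alpha]A@w$ infer $\Gamma;\Delta\Longrightarrow\exists\alpha.A@w$; $\exists$L: from $\Gamma;\Delta,A@u\Longrightarrow C@w$ infer $\Gamma;\Delta,\exists\alpha.A@u\Longrightarrow C@w$ ($\alpha$ fresh); !R: from $\Gamma;\cdot\Longrightarrow A@w$ infer $\Gamma;\cdot\Longrightarrow!A@w$; !L: from $\Gamma,A@u;\Delta\Longrightarrow C@w$ infer $\Gamma;\Delta,!A@u\Longrightarrow C@w$; at R: from $\Gamma;\Delta\Longrightarrow A@u$ infer $\Gamma;\Delta\Longrightarrow(A\ \mathrm{at}\ u)@v$; at L: from $\Gamma;\Delta,A@u\Longrightarrow C@w$ infer $\Gamma;\Delta,(A\ \mathrm{at}\ u)@v\Longrightarrow C@w$; $\downarrow$R: from $\Gamma;\Delta\Longrightarrow[w/u]A@w$ infer $\Gamma;\Delta\Longrightarrow\downarrow u.A@w$; $\downarrow$L: from $\Gamma;\Delta,[v/u]A@v\Longrightarrow C@w$ infer $\Gamma;\Delta,\downarrow u.A@v\Longrightarrow C@w$.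 Natural deduction: judgements $\Gamma;\Delta\vdash C@w$ generated by: hyp: $\Gamma;A@w\vdash A@w$; hyp!: $\Gamma,A@w;\cdot\vdash A@w$; introduction rules identical to the right rules above ($\otimes$I, $\mathbf1$I, $\multimap$I, $\&$I, $\top$I, $\oplus$I$_i$, $\forall$I, $\exists$I, !I, at I, $\downarrow$I, with $\vdash$ for $\Longrightarrow$); and eliminations: $\otimes$E: from $\Gamma;\Delta\vdash A\otimes B@w$, $\Gamma;\Delta',A@w,B@w\vdash C@w'$ infer $\Gamma;\Delta,\Delta'\vdash C@w'$; $\mathbf1$E: from $\Gamma;\Delta\vdash\mathbf1@w$, $\Gamma;\Delta'\vdash C@w'$ infer $\Gamma;\Delta,\Delta'\vdash C@w'$; $\multimap$E: from $\Gamma;\Delta\vdash A\multimap B@w$, $\Gamma;\Delta'\vdash A@w$ infer $\Gamma;\Delta,\Delta'\vdash B@w$; $\&$E$_i$: from $\Gamma;\Delta\vdash A_1\&A_2@w$ infer $\Gamma;\Delta\vdash A_i@w$; $\oplus$E: from $\Gamma;\Delta\vdash A\oplus B@w$, $\Gamma;\Delta',A@w\vdash C@w'$, $\Gamma;\Delta',B@w\vdash C@w'$ infer $\Gamma;\Delta,\Delta'\vdash C@w'$; $\mathbf0$E: from $\Gamma;\Delta\vdash\mathbf0@w$ infer $\Gamma;\Delta,\Delta'\vdash C@w'$; $\forall$E: from $\Gamma;\Delta\vdash\forall\alpha.A@w$ infer $\Gamma;\Delta\vdash[\tau/\alpha]A@w$; $\exists$E: from $\Gamma;\Delta\vdash\exists\alpha.A@w$,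 $\Gamma;\Delta',A@w\vdash C@w'$ ($\alpha$ fresh) infer $\Gamma;\Delta,\Delta'\vdash C@w'$; !E: from $\Gamma;\Delta\vdash!A@w$, $\Gamma,A@w;\Delta'\vdash C@w'$ infer $\Gamma;\Delta,\Delta'\vdash C@w'$; at E: from $\Gamma;\Delta\vdash(A\ \mathrm{at}\ w)@w'$ infer $\Gamma;\Delta\vdash A@w$; $\downarrow$E: from $\Gamma;\Delta\vdash\downarrow u.A@w$ infer $\Gamma;\Delta\vdash[w/u]A@w$. -}

module Defs where

open import Level using (Level)
open import Data.Nat using (ℕ; zero; suc)
open import Data.Fin using (Fin; zero; suc)
open import Data.Vec using (Vec; []; _∷_)
open import Data.List using (List; []; _∷_; _++_; [_]; map)
open import Data.List.Membership.Propositional using (_∈_)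
open import Data.List.Relation.Binary.Permutation.Propositional using (_↭_)
open import Algebra.Bundles using (Monoid)

record Signature : Set₁ where
  field
    FunSym    : Set
    funArity  : FunSym → ℕ
    PredSym   : Set
    predArity : PredSym → ℕ

-- Variables are de Bruijn indices (two separate sorts: term variables and
-- world variables), so propositions are identified up to α-conversion and
-- "α fresh" side-conditions become weakening into an extended scope.
module HyLL {c ℓ : Level} (S : Signature) (𝒲 : Monoid c ℓ) where
  open Signature S
  open Monoid 𝒲 using (Carrier)

  data Term (n : ℕ) : Set where
    var : Fin n → Term n
    fun : (f : FunSym) → Vec (Term n) (funArity f) → Term n

  mutual
    subT : ∀ {n n'} → (Fin n → Term n') → Term n → Term n'
    subT σ (var i)    = σ i
    subT σ (fun f ts) = fun f (subTs σ ts)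

    subTs : ∀ {n n' k} → (Fin n → Term n') → Vec (Term n) k → Vec (Term n') k
    subTs σ []       = []
    subTs σ (t ∷ ts) = subT σ t ∷ subTs σ ts

  wkT : ∀ {n} → Term n → Term (suc n)
  wkT = subT (λ i → var (suc i))

  liftT : ∀ {n n'} → (Fin n → Term n') → Fin (suc n) → Term (suc n')
  liftT σ zero    = var zero
  liftT σ (suc i) = wkT (σ i)

  infixl 7 _·_
  data World (m : ℕ) : Set c where
    wvar   : Fin m → World m
    wconst : Carrier → World m
    _·_    : World m → World m → World m

  subW : ∀ {m m'} → (Fin m → World m') → World m → World m'
  subW ρ (wvar i)   = ρ i
  subW ρ (wconst x) = wconst x
  subW ρ (u · v)    = subW ρ u · subW ρ v

  wkW : ∀ {m} → World m → World (suc m)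
  wkW = subW (λ i → wvar (suc i))

  liftW : ∀ {m m'} → (Fin m → World m') → Fin (suc m) → World (suc m')
  liftW ρ zero    = wvar zero
  liftW ρ (suc i) = wkW (ρ i)

  infixr 6 _⊗_ _&_ _⊕_
  infixr 5 _⊸_
  infix  8 !_
  infix  7 _at_
  data Prop (n m : ℕ) : Set c where
    atom        : (p : PredSym) → Vec (Term n) (predArity p) → Prop n m
    _⊗_ _⊸_ _&_ _⊕_ : Prop n m → Prop n m → Prop n m
    𝟏 ⊤ 𝟎       : Prop n m
    !_          : Prop n m → Prop n m
    Allᵗ Exᵗ    : Prop (suc n) m → Prop n m
    _at_        : Prop n m → World m → Prop n m
    Down Allʷ Exʷ : Prop n (suc m) → Prop n m

  subP : ∀ {n n' m m'} → (Fin n → Term n') → (Fin m → World m') → Prop n m → Prop n' m'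
  subP σ ρ (atom p ts) = atom p (subTs σ ts)
  subP σ ρ (A ⊗ B)     = subP σ ρ A ⊗ subP σ ρ B
  subP σ ρ (A ⊸ B)     = subP σ ρ A ⊸ subP σ ρ B
  subP σ ρ (A & B)     = subP σ ρ A & subP σ ρ B
  subP σ ρ (A ⊕ B)     = subP σ ρ A ⊕ subP σ ρ B
  subP σ ρ 𝟏           = 𝟏
  subP σ ρ ⊤           = ⊤
  subP σ ρ 𝟎           = 𝟎
  subP σ ρ (! A)       = ! subP σ ρ A
  subP σ ρ (Allᵗ A)    = Allᵗ (subP (liftT σ) ρ A)
  subP σ ρ (Exᵗ A)     = Exᵗ (subP (liftT σ) ρ A)
  subP σ ρ (A at w)    = subP σ ρ A at subW ρ w
  subP σ ρ (Down A)    = Down (subP σ (liftW ρ) A)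
  subP σ ρ (Allʷ A)    = Allʷ (subP σ (liftW ρ) A)
  subP σ ρ (Exʷ A)     = Exʷ (subP σ (liftW ρ) A)

  _▹ᵗ_ : ∀ {n n'} → Term n' → (Fin n → Term n') → Fin (suc n) → Term n'
  (t ▹ᵗ σ) zero    = t
  (t ▹ᵗ σ) (suc i) = σ i

  _▹ʷ_ : ∀ {m m'} → World m' → (Fin m → World m') → Fin (suc m) → World m'
  (w ▹ʷ ρ) zero    = w
  (w ▹ʷ ρ) (suc i) = ρ i

  [_/ᵗ]_ : ∀ {n m} → Term n → Prop (suc n) m → Prop n m
  [ t /ᵗ] A = subP (t ▹ᵗ var) wvar A

  [_/ʷ]_ : ∀ {n m} → World m → Prop n (suc m) → Prop n m
  [ w /ʷ] A = subP var (w ▹ʷ wvar) A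

  wkPᵗ : ∀ {n m} → Prop n m → Prop (suc n) m
  wkPᵗ = subP (λ i → var (suc i)) wvar

  wkPʷ : ∀ {n m} → Prop n m → Prop n (suc m)
  wkPʷ = subP var (λ i → wvar (suc i))

  infix 4 _＠_
  data Jdg (n m : ℕ) : Set c where
    _＠_ : Prop n m → World m → Jdg n m

  wkJᵗ : ∀ {n m} → Jdg n m → Jdg (suc n) m
  wkJᵗ (A ＠ w) = wkPᵗ A ＠ w

  wkJʷ : ∀ {n m} → Jdg n m → Jdg n (suc m)
  wkJʷ (A ＠ w) = wkPʷ A ＠ wkW w

  -- Contexts: Γ (a set) and Δ (a multiset) are represented by lists.
  -- Γ is only ever accessed by membership (_∈_) or extended, so derivability
  -- depends only on its underlying set; Δ is handled up to permutation (_↭_)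
  -- wherever the rules decompose it, so derivability depends only on the
  -- underlying multiset.
  Ctx : ℕ → ℕ → Set c
  Ctx n m = List (Jdg n m)

  private
    variable
      n m : ℕ
      Γ Δ Δ' Δ₁ Δ₂ : Ctx n m
      A B : Prop n m
      u v w w' : World m
      J : Jdg n m

  infix 2 _⨾_⟹_
  data _⨾_⟹_ : {n m : ℕ} → Ctx n m → Ctx n m → Jdg n m → Set c where
    init : ∀ {p ts} → Γ ⨾ [ atom p ts ＠ u ] ⟹ atom p ts ＠ u
    copy : (A ＠ u) ∈ Γ → Γ ⨾ (A ＠ u) ∷ Δ ⟹ J → Γ ⨾ Δ ⟹ J
    ⊗R   : Γ ⨾ Δ₁ ⟹ A ＠ w → Γ ⨾ Δ₂ ⟹ B ＠ w → Δ ↭ Δ₁ ++ Δ₂ → Γ ⨾ Δ ⟹ A ⊗ B ＠ w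
    ⊗L   : Γ ⨾ (A ＠ u) ∷ (B ＠ u) ∷ Δ ⟹ J → Δ' ↭ (A ⊗ B ＠ u) ∷ Δ → Γ ⨾ Δ' ⟹ J
    𝟏R   : Γ ⨾ [] ⟹ 𝟏 ＠ w
    𝟏L   : Γ ⨾ Δ ⟹ J → Δ' ↭ (𝟏 ＠ u) ∷ Δ → Γ ⨾ Δ' ⟹ J
    ⊸R   : Γ ⨾ (A ＠ w) ∷ Δ ⟹ B ＠ w → Γ ⨾ Δ ⟹ A ⊸ B ＠ w
    ⊸L   : Γ ⨾ Δ₁ ⟹ A ＠ u → Γ ⨾ (B ＠ u) ∷ Δ₂ ⟹ J → Δ ↭ (A ⊸ B ＠ u) ∷ (Δ₁ ++ Δ₂) → Γ ⨾ Δ ⟹ J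
    ⊤R   : Γ ⨾ Δ ⟹ ⊤ ＠ w
    &R   : Γ ⨾ Δ ⟹ A ＠ w → Γ ⨾ Δ ⟹ B ＠ w → Γ ⨾ Δ ⟹ A & B ＠ w
    &L₁  : Γ ⨾ (A ＠ u) ∷ Δ ⟹ J → Δ' ↭ (A & B ＠ u) ∷ Δ → Γ ⨾ Δ' ⟹ J
    &L₂  : Γ ⨾ (B ＠ u) ∷ Δ ⟹ J → Δ' ↭ (A & B ＠ u) ∷ Δ → Γ ⨾ Δ' ⟹ J
    ⊕R₁  : Γ ⨾ Δ ⟹ A ＠ w → Γ ⨾ Δ ⟹ A ⊕ B ＠ w
    ⊕R₂  : Γ ⨾ Δ ⟹ B ＠ w → Γ ⨾ Δ ⟹ A ⊕ B ＠ w
    ⊕L   : Γ ⨾ (A ＠ u) ∷ Δ ⟹ J → Γ ⨾ (B ＠ u) ∷ Δ ⟹ J → Δ' ↭ (A ⊕ B ＠ u) ∷ Δ → Γ ⨾ Δ' ⟹ J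
    𝟎L   : Δ' ↭ (𝟎 ＠ u) ∷ Δ → Γ ⨾ Δ' ⟹ J
    ∀ᵗR  : {A : Prop (suc n) m} → map wkJᵗ Γ ⨾ map wkJᵗ Δ ⟹ A ＠ w → Γ ⨾ Δ ⟹ Allᵗ A ＠ w
    ∀ʷR  : {A : Prop n (suc m)} → map wkJʷ Γ ⨾ map wkJʷ Δ ⟹ A ＠ wkW w → Γ ⨾ Δ ⟹ Allʷ A ＠ w
    ∀ᵗL  : {A : Prop (suc n) m} (t : Term n) → Γ ⨾ ([ t /ᵗ] A ＠ u) ∷ Δ ⟹ J → Δ' ↭ (Allᵗ A ＠ u) ∷ Δ → Γ ⨾ Δ' ⟹ J
    ∀ʷL  : {A : Prop n (suc m)} (v : World m) → Γ ⨾ ([ v /ʷ] A ＠ u) ∷ Δ ⟹ J → Δ' ↭ (Allʷ A ＠ u) ∷ Δ → Γ ⨾ Δ' ⟹ J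
    ∃ᵗR  : {A : Prop (suc n) m} (t : Term n) → Γ ⨾ Δ ⟹ [ t /ᵗ] A ＠ w → Γ ⨾ Δ ⟹ Exᵗ A ＠ w
    ∃ʷR  : {A : Prop n (suc m)} (v : World m) → Γ ⨾ Δ ⟹ [ v /ʷ] A ＠ w → Γ ⨾ Δ ⟹ Exʷ A ＠ w
    ∃ᵗL  : {A : Prop (suc n) m} → map wkJᵗ Γ ⨾ (A ＠ u) ∷ map wkJᵗ Δ ⟹ wkJᵗ J → Δ' ↭ (Exᵗ A ＠ u) ∷ Δ → Γ ⨾ Δ' ⟹ J
    ∃ʷL  : {A : Prop n (suc m)} → map wkJʷ Γ ⨾ (A ＠ wkW u) ∷ map wkJʷ Δ ⟹ wkJʷ J → Δ' ↭ (Exʷ A ＠ u) ∷ Δ → Γ ⨾ Δ' ⟹ J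
    !R   : Γ ⨾ [] ⟹ A ＠ w → Γ ⨾ [] ⟹ ! A ＠ w
    !L   : (A ＠ u) ∷ Γ ⨾ Δ ⟹ J → Δ' ↭ (! A ＠ u) ∷ Δ → Γ ⨾ Δ' ⟹ J
    atR  : Γ ⨾ Δ ⟹ A ＠ u → Γ ⨾ Δ ⟹ (A at u) ＠ v
    atL  : Γ ⨾ (A ＠ u) ∷ Δ ⟹ J → Δ' ↭ ((A at u) ＠ v) ∷ Δ → Γ ⨾ Δ' ⟹ J
    ↓R   : {A : Prop n (suc m)} → Γ ⨾ Δ ⟹ [ w /ʷ] A ＠ w → Γ ⨾ Δ ⟹ Down A ＠ w
    ↓L   : {A : Prop n (suc m)} → Γ ⨾ ([ v /ʷ] A ＠ v) ∷ Δ ⟹ J → Δ' ↭ (Down A ＠ v) ∷ Δ → Γ ⨾ Δ' ⟹ J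

  infix 2 _⨾_⊢_
  data _⨾_⊢_ : {n m : ℕ} → Ctx n m → Ctx n m → Jdg n m → Set c where
    hyp  : Γ ⨾ [ J ] ⊢ J
    hyp! : J ∈ Γ → Γ ⨾ [] ⊢ J
    ⊗I   : Γ ⨾ Δ₁ ⊢ A ＠ w → Γ ⨾ Δ₂ ⊢ B ＠ w → Δ ↭ Δ₁ ++ Δ₂ → Γ ⨾ Δ ⊢ A ⊗ B ＠ w
    𝟏I   : Γ ⨾ [] ⊢ 𝟏 ＠ w
    ⊸I   : Γ ⨾ (A ＠ w) ∷ Δ ⊢ B ＠ w → Γ ⨾ Δ ⊢ A ⊸ B ＠ w
    &I   : Γ ⨾ Δ ⊢ A ＠ w → Γ ⨾ Δ ⊢ B ＠ w → Γ ⨾ Δ ⊢ A & B ＠ w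
    ⊤I   : Γ ⨾ Δ ⊢ ⊤ ＠ w
    ⊕I₁  : Γ ⨾ Δ ⊢ A ＠ w → Γ ⨾ Δ ⊢ A ⊕ B ＠ w
    ⊕I₂  : Γ ⨾ Δ ⊢ B ＠ w → Γ ⨾ Δ ⊢ A ⊕ B ＠ w
    ∀ᵗI  : {A : Prop (suc n) m} → map wkJᵗ Γ ⨾ map wkJᵗ Δ ⊢ A ＠ w → Γ ⨾ Δ ⊢ Allᵗ A ＠ w
    ∀ʷI  : {A : Prop n (suc m)} → map wkJʷ Γ ⨾ map wkJʷ Δ ⊢ A ＠ wkW w → Γ ⨾ Δ ⊢ Allʷ A ＠ w
    ∃ᵗI  : {A : Prop (suc n) m} (t : Term n) → Γ ⨾ Δ ⊢ [ t /ᵗ] A ＠ w → Γ ⨾ Δ ⊢ Exᵗ A ＠ w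
    ∃ʷI  : {A : Prop n (suc m)} (v : World m) → Γ ⨾ Δ ⊢ [ v /ʷ] A ＠ w → Γ ⨾ Δ ⊢ Exʷ A ＠ w
    !I   : Γ ⨾ [] ⊢ A ＠ w → Γ ⨾ [] ⊢ ! A ＠ w
    atI  : Γ ⨾ Δ ⊢ A ＠ u → Γ ⨾ Δ ⊢ (A at u) ＠ v
    ↓I   : {A : Prop n (suc m)} → Γ ⨾ Δ ⊢ [ w /ʷ] A ＠ w → Γ ⨾ Δ ⊢ Down A ＠ w
    ⊗E   : Γ ⨾ Δ₁ ⊢ A ⊗ B ＠ w → Γ ⨾ (A ＠ w) ∷ (B ＠ w) ∷ Δ₂ ⊢ J → Δ ↭ Δ₁ ++ Δ₂ → Γ ⨾ Δ ⊢ J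
    𝟏E   : Γ ⨾ Δ₁ ⊢ 𝟏 ＠ w → Γ ⨾ Δ₂ ⊢ J → Δ ↭ Δ₁ ++ Δ₂ → Γ ⨾ Δ ⊢ J
    ⊸E   : Γ ⨾ Δ₁ ⊢ A ⊸ B ＠ w → Γ ⨾ Δ₂ ⊢ A ＠ w → Δ ↭ Δ₁ ++ Δ₂ → Γ ⨾ Δ ⊢ B ＠ w
    &E₁  : Γ ⨾ Δ ⊢ A & B ＠ w → Γ ⨾ Δ ⊢ A ＠ w
    &E₂  : Γ ⨾ Δ ⊢ A & B ＠ w → Γ ⨾ Δ ⊢ B ＠ w
    ⊕E   : Γ ⨾ Δ₁ ⊢ A ⊕ B ＠ w → Γ ⨾ (A ＠ w) ∷ Δ₂ ⊢ J → Γ ⨾ (B ＠ w) ∷ Δ₂ ⊢ J → Δ ↭ Δ₁ ++ Δ₂ → Γ ⨾ Δ ⊢ J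
    𝟎E   : Γ ⨾ Δ₁ ⊢ 𝟎 ＠ w → Δ ↭ Δ₁ ++ Δ₂ → Γ ⨾ Δ ⊢ J
    ∀ᵗE  : {A : Prop (suc n) m} (t : Term n) → Γ ⨾ Δ ⊢ Allᵗ A ＠ w → Γ ⨾ Δ ⊢ [ t /ᵗ] A ＠ w
    ∀ʷE  : {A : Prop n (suc m)} (v : World m) → Γ ⨾ Δ ⊢ Allʷ A ＠ w → Γ ⨾ Δ ⊢ [ v /ʷ] A ＠ w
    ∃ᵗE  : {A : Prop (suc n) m} → Γ ⨾ Δ₁ ⊢ Exᵗ A ＠ w → map wkJᵗ Γ ⨾ (A ＠ w) ∷ map wkJᵗ Δ₂ ⊢ wkJᵗ J → Δ ↭ Δ₁ ++ Δ₂ → Γ ⨾ Δ ⊢ J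
    ∃ʷE  : {A : Prop n (suc m)} → Γ ⨾ Δ₁ ⊢ Exʷ A ＠ w → map wkJʷ Γ ⨾ (A ＠ wkW w) ∷ map wkJʷ Δ₂ ⊢ wkJʷ J → Δ ↭ Δ₁ ++ Δ₂ → Γ ⨾ Δ ⊢ J
    !E   : Γ ⨾ Δ₁ ⊢ ! A ＠ w → (A ＠ w) ∷ Γ ⨾ Δ₂ ⊢ J → Δ ↭ Δ₁ ++ Δ₂ → Γ ⨾ Δ ⊢ J
    atE  : Γ ⨾ Δ ⊢ (A at w) ＠ w' → Γ ⨾ Δ ⊢ A ＠ w
    ↓E   : {A : Prop n (suc m)} → Γ ⨾ Δ ⊢ Down A ＠ w → Γ ⨾ Δ ⊢ [ w /ʷ] A ＠ w

module Submission where

-- Soundness translates rule by rule: right rules are introductions, and a left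
-- rule is an elimination on its principal hypothesis followed by a
-- natural-deduction cut, which is derivable through ⊸ and at.
--
-- Completeness turns each elimination into a cut against the matching left
-- rule, so it rests on identity expansion and on cut admissibility.  Cut is
-- proved by induction on the cut formula, then on the derivation D of it, then
-- on the derivation using it.  To keep the quantifier cases structural, D is
-- cut under an arbitrary substitution of terms and worlds; a second cut handles
-- unrestricted hypotheses.

open import Defs
open import Level using (Level)
open import Function using (_∘_; id)
open import Algebra.Bundles using (Monoid)
open import Data.Nat using (ℕ; zero; suc; _≤_; _+_; s≤s)
open import Data.Nat.Properties using (m+n≤o⇒m≤o; m+n≤o⇒n≤o; ≤-refl; ≤-reflexive; ≤-trans)
open import Data.Fin using (Fin; zero; suc)
open import Data.Vec using (Vec; []; _∷_)
open import Data.List using (List; []; _∷_; _++_; [_]; map)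
import Data.List.Properties as List
open import Data.List.Membership.Propositional using (_∈_)
open import Data.List.Membership.Propositional.Properties using (∈-map⁺; ∈-map⁻; ∈-++⁻; ∈-∃++)
open import Data.List.Relation.Unary.Any using (here; there)
open import Data.List.Relation.Binary.Permutation.Propositional using (_↭_; prep; swap; ↭-refl; ↭-reflexive; ↭-sym; ↭-trans)
open import Data.List.Relation.Binary.Permutation.Propositional.Properties using (map⁺; ++⁺ˡ; ++⁺ʳ; shift; shifts; drop-∷; ∈-resp-↭; ↭-singleton-inv; ↭-empty-inv; ¬x∷xs↭[]; ++-comm)
open import Data.Product using (_×_; _,_; ∃)
open import Data.Sum using (_⊎_; inj₁; inj₂)
open import Data.Empty using (⊥; ⊥-elim)
open import Data.Unit using () renaming (⊤ to Unit)
open import Relation.Binary.PropositionalEquality using (_≡_; refl; sym; trans; cong; cong₂; subst)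

_⊆[_]_ : ∀ {a} {X Y : Set a} → List X → (X → Y) → List Y → Set a
xs ⊆[ θ ] ys = ∀ {x} → x ∈ xs → θ x ∈ ys

module _ {a : Level} {X : Set a} where

  ↭-front : ∀ {x : X} {xs} → x ∈ xs → ∃ λ ys → xs ↭ x ∷ ys
  ↭-front {x} x∈xs with ∈-∃++ x∈xs
  ... | us , vs , refl = us ++ vs , shift x us vs

  ↭-∷-inv : ∀ {x y : X} {xs ys} → x ∷ xs ↭ y ∷ ys →
            (x ≡ y × xs ↭ ys) ⊎ (∃ λ zs → xs ↭ y ∷ zs × ys ↭ x ∷ zs)
  ↭-∷-inv {x} {y} p with ∈-resp-↭ (↭-sym p) (here refl)
  ... | here refl = inj₁ (refl , drop-∷ p)
  ... | there y∈xs with ↭-front y∈xs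
  ... | zs , q = inj₂ (zs , q , ↭-sym (drop-∷ (↭-trans (swap y x ↭-refl) (↭-trans (prep x (↭-sym q)) p))))

  ↭-++-inv : ∀ {x : X} {xs} ys {zs} → x ∷ xs ↭ ys ++ zs →
             (∃ λ ys' → ys ↭ x ∷ ys' × xs ↭ ys' ++ zs) ⊎ (∃ λ zs' → zs ↭ x ∷ zs' × xs ↭ ys ++ zs')
  ↭-++-inv {x} ys {zs} p with ∈-++⁻ ys (∈-resp-↭ p (here refl))
  ... | inj₁ x∈ys with ↭-front x∈ys
  ...   | ys' , q = inj₁ (ys' , q , drop-∷ (↭-trans p (++⁺ʳ zs q)))
  ↭-++-inv {x} ys {zs} p | inj₂ x∈zs with ↭-front x∈zs
  ...   | zs' , q = inj₂ (zs' , q , drop-∷ (↭-trans p (↭-trans (++⁺ˡ ys q) (shift x ys zs'))))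

  ↭-under : ∀ (x : X) {y xs ys} → xs ↭ y ∷ ys → x ∷ xs ↭ y ∷ x ∷ ys
  ↭-under x q = ↭-trans (prep x q) (swap x _ ↭-refl)

  ↭-under₂ : ∀ (x x' : X) {y xs ys} → xs ↭ y ∷ ys → x ∷ x' ∷ xs ↭ y ∷ x ∷ x' ∷ ys
  ↭-under₂ x x' q = ↭-trans (prep x (↭-under x' q)) (swap x _ ↭-refl)

  ↭-behind : ∀ (ws : List X) {xs y ys} → xs ↭ y ∷ ys → ws ++ xs ↭ y ∷ ws ++ ys
  ↭-behind ws {y = y} {ys} q = ↭-trans (++⁺ˡ ws q) (shift y ws ys)

  ↭-map-head : ∀ {Y : Set a} (f : X → Y) {xs ys x zs} → map f xs ↭ ys → xs ↭ x ∷ zs → ys ↭ f x ∷ map f zs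
  ↭-map-head f p q = ↭-trans (↭-sym p) (map⁺ f q)

  map⁺-++ : ∀ {Y : Set a} (f : X → Y) {xs ys zs} → xs ↭ ys ++ zs → map f xs ↭ map f ys ++ map f zs
  map⁺-++ f {ys = ys} {zs} q = ↭-trans (map⁺ f q) (↭-reflexive (List.map-++ f ys zs))

  map-triangle : ∀ {Y Z : Set a} {f : X → Z} {g : Y → Z} {h : X → Y} → (∀ x → f x ≡ g (h x)) → ∀ xs → map f xs ≡ map g (map h xs)
  map-triangle e xs = trans (List.map-cong e xs) (List.map-∘ xs)

  map-cancel : ∀ {Y : Set a} {f : Y → X} {g : X → Y} → (∀ x → f (g x) ≡ x) → ∀ xs → map f (map g xs) ≡ xs
  map-cancel e xs = trans (sym (List.map-∘ xs)) (trans (List.map-cong e xs) (List.map-id xs))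

  map-square : ∀ {Y Z W : Set a} {f : Y → Z} {g : X → Y} {h : W → Z} {k : X → W}
             → (∀ x → f (g x) ≡ h (k x)) → ∀ xs → map f (map g xs) ≡ map h (map k xs)
  map-square e xs = trans (sym (List.map-∘ xs)) (trans (List.map-cong e xs) (List.map-∘ xs))

  ⊆-∷ : ∀ {Y : Set a} {θ : X → Y} {x xs ys} → xs ⊆[ θ ] ys → (x ∷ xs) ⊆[ θ ] (θ x ∷ ys)
  ⊆-∷ inc (here refl) = here refl
  ⊆-∷ inc (there x∈) = there (inc x∈)

  ⊆-mapʳ : ∀ {Y Z : Set a} {f : Y → Z} {θ : X → Y} {θ' : X → Z} {xs ys}
         → (∀ x → f (θ x) ≡ θ' x) → xs ⊆[ θ ] ys → xs ⊆[ θ' ] map f ys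
  ⊆-mapʳ {f = f} e inc {x} x∈ = subst (_∈ _) (e x) (∈-map⁺ f (inc x∈))

  ⊆-mapˡ : ∀ {Y Z : Set a} {g : X → Y} {θ : X → Z} {θ' : Y → Z} {xs ys}
         → (∀ x → θ' (g x) ≡ θ x) → xs ⊆[ θ ] ys → map g xs ⊆[ θ' ] ys
  ⊆-mapˡ {g = g} e inc y∈ with ∈-map⁻ g y∈
  ... | x , x∈ , refl = subst (_∈ _) (sym (e x)) (inc x∈)

  ⊆-map-∷ : ∀ {Y : Set a} {f : X → Y} {x y xs ys} → f x ≡ y → xs ⊆[ id ] (x ∷ ys) → map f xs ⊆[ id ] (y ∷ map f ys)
  ⊆-map-∷ {f = f} refl inc y∈ with ∈-map⁻ f y∈
  ... | x , x∈ , refl with inc x∈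
  ...   | here refl = here refl
  ...   | there x∈ys = there (∈-map⁺ f x∈ys)

  ⊆-∷-skip : ∀ {x y : X} {xs ys} → xs ⊆[ id ] (x ∷ ys) → (y ∷ xs) ⊆[ id ] (x ∷ y ∷ ys)
  ⊆-∷-skip inc (here refl) = there (here refl)
  ⊆-∷-skip inc (there x∈) with inc x∈
  ... | here refl = here refl
  ... | there x∈ys = there (there x∈ys)

module Metatheory {c ℓ : Level} (S : Signature) (𝒲 : Monoid c ℓ) where
  open HyLL S 𝒲

  mutual
    subT-cong : ∀ {n n'} {σ σ' : Fin n → Term n'} → (∀ i → σ i ≡ σ' i) → ∀ t → subT σ t ≡ subT σ' t
    subT-cong e (var i)    = e i
    subT-cong e (fun f ts) = cong (fun f) (subTs-cong e ts)

    subTs-cong : ∀ {n n' k} {σ σ' : Fin n → Term n'} → (∀ i → σ i ≡ σ' i) → (ts : Vec (Term n) k) → subTs σ ts ≡ subTs σ' ts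
    subTs-cong e []       = refl
    subTs-cong e (t ∷ ts) = cong₂ _∷_ (subT-cong e t) (subTs-cong e ts)

  mutual
    subT-∘ : ∀ {n n' n''} (σ : Fin n' → Term n'') (σ' : Fin n → Term n') t → subT σ (subT σ' t) ≡ subT (subT σ ∘ σ') t
    subT-∘ σ σ' (var i)    = refl
    subT-∘ σ σ' (fun f ts) = cong (fun f) (subTs-∘ σ σ' ts)

    subTs-∘ : ∀ {n n' n'' k} (σ : Fin n' → Term n'') (σ' : Fin n → Term n') (ts : Vec (Term n) k)
            → subTs σ (subTs σ' ts) ≡ subTs (subT σ ∘ σ') ts
    subTs-∘ σ σ' []       = refl
    subTs-∘ σ σ' (t ∷ ts) = cong₂ _∷_ (subT-∘ σ σ' t) (subTs-∘ σ σ' ts)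

  mutual
    subT-id : ∀ {n} (t : Term n) → subT var t ≡ t
    subT-id (var i)    = refl
    subT-id (fun f ts) = cong (fun f) (subTs-id ts)

    subTs-id : ∀ {n k} (ts : Vec (Term n) k) → subTs var ts ≡ ts
    subTs-id []       = refl
    subTs-id (t ∷ ts) = cong₂ _∷_ (subT-id t) (subTs-id ts)

  subW-cong : ∀ {m m'} {ρ ρ' : Fin m → World m'} → (∀ i → ρ i ≡ ρ' i) → ∀ w → subW ρ w ≡ subW ρ' w
  subW-cong e (wvar i)   = e i
  subW-cong e (wconst x) = refl
  subW-cong e (u · v)    = cong₂ _·_ (subW-cong e u) (subW-cong e v)

  subW-∘ : ∀ {m m' m''} (ρ : Fin m' → World m'') (ρ' : Fin m → World m') w → subW ρ (subW ρ' w) ≡ subW (subW ρ ∘ ρ') w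
  subW-∘ ρ ρ' (wvar i)   = refl
  subW-∘ ρ ρ' (wconst x) = refl
  subW-∘ ρ ρ' (u · v)    = cong₂ _·_ (subW-∘ ρ ρ' u) (subW-∘ ρ ρ' v)

  subW-id : ∀ {m} (w : World m) → subW wvar w ≡ w
  subW-id (wvar i)   = refl
  subW-id (wconst x) = refl
  subW-id (u · v)    = cong₂ _·_ (subW-id u) (subW-id v)

  subW-fusion : ∀ {m₁ m₂ m₃ m'} {ρ : Fin m₁ → World m'} {ρ' : Fin m₂ → World m₁} {ρ₂ : Fin m₃ → World m'} {ρ₂' : Fin m₂ → World m₃}
              → (∀ i → subW ρ (ρ' i) ≡ subW ρ₂ (ρ₂' i)) → ∀ w → subW ρ (subW ρ' w) ≡ subW ρ₂ (subW ρ₂' w)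
  subW-fusion {ρ = ρ} {ρ'} {ρ₂} {ρ₂'} e w = trans (subW-∘ ρ ρ' w) (trans (subW-cong e w) (sym (subW-∘ ρ₂ ρ₂' w)))

  liftT-cong : ∀ {n n'} {σ σ' : Fin n → Term n'} → (∀ i → σ i ≡ σ' i) → ∀ i → liftT σ i ≡ liftT σ' i
  liftT-cong e zero    = refl
  liftT-cong e (suc i) = cong wkT (e i)

  liftT-∘ : ∀ {n n' n''} (σ : Fin n' → Term n'') (σ' : Fin n → Term n') i → subT (liftT σ) (liftT σ' i) ≡ liftT (subT σ ∘ σ') i
  liftT-∘ σ σ' zero    = refl
  liftT-∘ σ σ' (suc i) = trans (subT-∘ (liftT σ) (var ∘ suc) (σ' i)) (sym (subT-∘ (var ∘ suc) σ (σ' i)))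

  liftT-id : ∀ {n} i → liftT (var {n}) i ≡ var i
  liftT-id zero    = refl
  liftT-id (suc i) = refl

  liftW-cong : ∀ {m m'} {ρ ρ' : Fin m → World m'} → (∀ i → ρ i ≡ ρ' i) → ∀ i → liftW ρ i ≡ liftW ρ' i
  liftW-cong e zero    = refl
  liftW-cong e (suc i) = cong wkW (e i)

  liftW-∘ : ∀ {m m' m''} (ρ : Fin m' → World m'') (ρ' : Fin m → World m') i → subW (liftW ρ) (liftW ρ' i) ≡ liftW (subW ρ ∘ ρ') i
  liftW-∘ ρ ρ' zero    = refl
  liftW-∘ ρ ρ' (suc i) = trans (subW-∘ (liftW ρ) (wvar ∘ suc) (ρ' i)) (sym (subW-∘ (wvar ∘ suc) ρ (ρ' i)))

  liftW-id : ∀ {m} i → liftW (wvar {m}) i ≡ wvar i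
  liftW-id zero    = refl
  liftW-id (suc i) = refl

  subP-cong : ∀ {n n' m m'} {σ σ' : Fin n → Term n'} {ρ ρ' : Fin m → World m'}
            → (∀ i → σ i ≡ σ' i) → (∀ i → ρ i ≡ ρ' i) → ∀ A → subP σ ρ A ≡ subP σ' ρ' A
  subP-cong e f (atom p ts) = cong (atom p) (subTs-cong e ts)
  subP-cong e f (A ⊗ B)     = cong₂ _⊗_ (subP-cong e f A) (subP-cong e f B)
  subP-cong e f (A ⊸ B)     = cong₂ _⊸_ (subP-cong e f A) (subP-cong e f B)
  subP-cong e f (A & B)     = cong₂ _&_ (subP-cong e f A) (subP-cong e f B)
  subP-cong e f (A ⊕ B)     = cong₂ _⊕_ (subP-cong e f A) (subP-cong e f B)
  subP-cong e f 𝟏           = refl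
  subP-cong e f ⊤           = refl
  subP-cong e f 𝟎           = refl
  subP-cong e f (! A)       = cong !_ (subP-cong e f A)
  subP-cong e f (Allᵗ A)    = cong Allᵗ (subP-cong (liftT-cong e) f A)
  subP-cong e f (Exᵗ A)     = cong Exᵗ (subP-cong (liftT-cong e) f A)
  subP-cong e f (A at w)    = cong₂ _at_ (subP-cong e f A) (subW-cong f w)
  subP-cong e f (Down A)    = cong Down (subP-cong e (liftW-cong f) A)
  subP-cong e f (Allʷ A)    = cong Allʷ (subP-cong e (liftW-cong f) A)
  subP-cong e f (Exʷ A)     = cong Exʷ (subP-cong e (liftW-cong f) A)

  subP-∘ : ∀ {n n' n'' m m' m''} (σ : Fin n' → Term n'') (σ' : Fin n → Term n') (ρ : Fin m' → World m'') (ρ' : Fin m → World m') A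
         → subP σ ρ (subP σ' ρ' A) ≡ subP (subT σ ∘ σ') (subW ρ ∘ ρ') A
  subP-∘ σ σ' ρ ρ' (atom p ts) = cong (atom p) (subTs-∘ σ σ' ts)
  subP-∘ σ σ' ρ ρ' (A ⊗ B)     = cong₂ _⊗_ (subP-∘ σ σ' ρ ρ' A) (subP-∘ σ σ' ρ ρ' B)
  subP-∘ σ σ' ρ ρ' (A ⊸ B)     = cong₂ _⊸_ (subP-∘ σ σ' ρ ρ' A) (subP-∘ σ σ' ρ ρ' B)
  subP-∘ σ σ' ρ ρ' (A & B)     = cong₂ _&_ (subP-∘ σ σ' ρ ρ' A) (subP-∘ σ σ' ρ ρ' B)
  subP-∘ σ σ' ρ ρ' (A ⊕ B)     = cong₂ _⊕_ (subP-∘ σ σ' ρ ρ' A) (subP-∘ σ σ' ρ ρ' B)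
  subP-∘ σ σ' ρ ρ' 𝟏           = refl
  subP-∘ σ σ' ρ ρ' ⊤           = refl
  subP-∘ σ σ' ρ ρ' 𝟎           = refl
  subP-∘ σ σ' ρ ρ' (! A)       = cong !_ (subP-∘ σ σ' ρ ρ' A)
  subP-∘ σ σ' ρ ρ' (Allᵗ A)    = cong Allᵗ (trans (subP-∘ (liftT σ) (liftT σ') ρ ρ' A) (subP-cong (liftT-∘ σ σ') (λ _ → refl) A))
  subP-∘ σ σ' ρ ρ' (Exᵗ A)     = cong Exᵗ (trans (subP-∘ (liftT σ) (liftT σ') ρ ρ' A) (subP-cong (liftT-∘ σ σ') (λ _ → refl) A))
  subP-∘ σ σ' ρ ρ' (A at w)    = cong₂ _at_ (subP-∘ σ σ' ρ ρ' A) (subW-∘ ρ ρ' w)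
  subP-∘ σ σ' ρ ρ' (Down A)    = cong Down (trans (subP-∘ σ σ' (liftW ρ) (liftW ρ') A) (subP-cong (λ _ → refl) (liftW-∘ ρ ρ') A))
  subP-∘ σ σ' ρ ρ' (Allʷ A)    = cong Allʷ (trans (subP-∘ σ σ' (liftW ρ) (liftW ρ') A) (subP-cong (λ _ → refl) (liftW-∘ ρ ρ') A))
  subP-∘ σ σ' ρ ρ' (Exʷ A)     = cong Exʷ (trans (subP-∘ σ σ' (liftW ρ) (liftW ρ') A) (subP-cong (λ _ → refl) (liftW-∘ ρ ρ') A))

  subP-id : ∀ {n m} (A : Prop n m) → subP var wvar A ≡ A
  subP-id (atom p ts) = cong (atom p) (subTs-id ts)
  subP-id (A ⊗ B)     = cong₂ _⊗_ (subP-id A) (subP-id B)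
  subP-id (A ⊸ B)     = cong₂ _⊸_ (subP-id A) (subP-id B)
  subP-id (A & B)     = cong₂ _&_ (subP-id A) (subP-id B)
  subP-id (A ⊕ B)     = cong₂ _⊕_ (subP-id A) (subP-id B)
  subP-id 𝟏           = refl
  subP-id ⊤           = refl
  subP-id 𝟎           = refl
  subP-id (! A)       = cong !_ (subP-id A)
  subP-id (Allᵗ A)    = cong Allᵗ (trans (subP-cong liftT-id (λ _ → refl) A) (subP-id A))
  subP-id (Exᵗ A)     = cong Exᵗ (trans (subP-cong liftT-id (λ _ → refl) A) (subP-id A))
  subP-id (A at w)    = cong₂ _at_ (subP-id A) (subW-id w)
  subP-id (Down A)    = cong Down (trans (subP-cong (λ _ → refl) liftW-id A) (subP-id A))
  subP-id (Allʷ A)    = cong Allʷ (trans (subP-cong (λ _ → refl) liftW-id A) (subP-id A))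
  subP-id (Exʷ A)     = cong Exʷ (trans (subP-cong (λ _ → refl) liftW-id A) (subP-id A))

  subP-fusion : ∀ {n₁ n₂ n₃ n' m₁ m₂ m₃ m'}
                {σ : Fin n₁ → Term n'} {σ' : Fin n₂ → Term n₁} {σ₂ : Fin n₃ → Term n'} {σ₂' : Fin n₂ → Term n₃}
                {ρ : Fin m₁ → World m'} {ρ' : Fin m₂ → World m₁} {ρ₂ : Fin m₃ → World m'} {ρ₂' : Fin m₂ → World m₃}
              → (∀ i → subT σ (σ' i) ≡ subT σ₂ (σ₂' i)) → (∀ i → subW ρ (ρ' i) ≡ subW ρ₂ (ρ₂' i))
              → ∀ A → subP σ ρ (subP σ' ρ' A) ≡ subP σ₂ ρ₂ (subP σ₂' ρ₂' A)
  subP-fusion {σ = σ} {σ'} {σ₂} {σ₂'} {ρ} {ρ'} {ρ₂} {ρ₂'} e f A =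
    trans (subP-∘ σ σ' ρ ρ' A) (trans (subP-cong e f A) (sym (subP-∘ σ₂ σ₂' ρ₂ ρ₂' A)))

  subJ : ∀ {n n' m m'} → (Fin n → Term n') → (Fin m → World m') → Jdg n m → Jdg n' m'
  subJ σ ρ (A ＠ w) = subP σ ρ A ＠ subW ρ w

  subJ-id : ∀ {n m} (x : Jdg n m) → subJ var wvar x ≡ x
  subJ-id (A ＠ w) = cong₂ _＠_ (subP-id A) (subW-id w)

  map-subJ-id : ∀ {n m} (Δ : Ctx n m) → map (subJ var wvar) Δ ≡ Δ
  map-subJ-id Δ = trans (List.map-cong subJ-id Δ) (List.map-id Δ)

  ⊆-subJ-id : ∀ {n m} {Γ Γ' : Ctx n m} → Γ ⊆[ id ] Γ' → Γ ⊆[ subJ var wvar ] Γ'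
  ⊆-subJ-id inc {x} x∈ = subst (_∈ _) (sym (subJ-id x)) (inc x∈)

  wkJᵗ-as-subJ : ∀ {n m} (x : Jdg n m) → subJ (var ∘ suc) wvar x ≡ wkJᵗ x
  wkJᵗ-as-subJ (A ＠ w) = cong (wkPᵗ A ＠_) (subW-id w)

  wkJʷ-as-subJ : ∀ {n m} (x : Jdg n m) → subJ var (wvar ∘ suc) x ≡ wkJʷ x
  wkJʷ-as-subJ (A ＠ w) = refl

  open-fresh-ᵗ : ∀ {n m} (A : Prop (suc n) m) → [ var zero /ᵗ] (subP (liftT (var ∘ suc)) wvar A) ≡ A
  open-fresh-ᵗ A = trans (subP-∘ _ _ _ _ A) (trans (subP-cong e (λ _ → refl) A) (subP-id A))
    where
    e : ∀ i → subT (var zero ▹ᵗ var) (liftT (var ∘ suc) i) ≡ var i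
    e zero    = refl
    e (suc i) = refl

  open-fresh-ʷ : ∀ {n m} (A : Prop n (suc m)) → [ wvar zero /ʷ] (subP var (liftW (wvar ∘ suc)) A) ≡ A
  open-fresh-ʷ A = trans (subP-∘ _ _ _ _ A) (trans (subP-cong (λ i → refl) e A) (subP-id A))
    where
    e : ∀ i → subW (wvar zero ▹ʷ wvar) (liftW (wvar ∘ suc) i) ≡ wvar i
    e zero    = refl
    e (suc i) = refl

  ▹ʷ-wkW : ∀ {m} (v : World m) w → subW (v ▹ʷ wvar) (wkW w) ≡ w
  ▹ʷ-wkW v w = trans (subW-∘ _ _ w) (subW-id w)

  module _ {n n' m m' : ℕ} (σ : Fin n → Term n') (ρ : Fin m → World m') where

    wkJᵗ-subJ : ∀ x → wkJᵗ (subJ σ ρ x) ≡ subJ (liftT σ) ρ (wkJᵗ x)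
    wkJᵗ-subJ (A ＠ w) = cong (_＠ subW ρ w) (subP-fusion (λ _ → refl) (λ i → subW-id (ρ i)) A)

    wkJᵗ-subJ′ : ∀ x → wkJᵗ (subJ σ ρ x) ≡ subJ (wkT ∘ σ) ρ x
    wkJᵗ-subJ′ (A ＠ w) = cong (_＠ subW ρ w) (trans (subP-∘ _ σ _ ρ A) (subP-cong (λ _ → refl) (λ i → subW-id (ρ i)) A))

    wkW-subW : ∀ w → wkW (subW ρ w) ≡ subW (liftW ρ) (wkW w)
    wkW-subW w = subW-fusion (λ _ → refl) w

    wkJʷ-subJ : ∀ x → wkJʷ (subJ σ ρ x) ≡ subJ σ (liftW ρ) (wkJʷ x)
    wkJʷ-subJ (A ＠ w) = cong₂ _＠_ (subP-fusion (λ i → subT-id (σ i)) (λ _ → refl) A) (wkW-subW w)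

    wkJʷ-subJ′ : ∀ x → wkJʷ (subJ σ ρ x) ≡ subJ σ (wkW ∘ ρ) x
    wkJʷ-subJ′ (A ＠ w) = cong₂ _＠_ (trans (subP-∘ _ σ _ ρ A) (subP-cong (λ i → subT-id (σ i)) (λ _ → refl) A)) (subW-∘ _ ρ w)

    subP-[/ᵗ] : ∀ (t : Term n) A → subP σ ρ ([ t /ᵗ] A) ≡ [ subT σ t /ᵗ] (subP (liftT σ) ρ A)
    subP-[/ᵗ] t A = subP-fusion e (λ i → sym (subW-id (ρ i))) A
      where
      e : ∀ i → subT σ ((t ▹ᵗ var) i) ≡ subT (subT σ t ▹ᵗ var) (liftT σ i)
      e zero    = refl
      e (suc j) = sym (trans (subT-∘ _ _ (σ j)) (subT-id (σ j)))

    subP-[/ʷ] : ∀ (v : World m) A → subP σ ρ ([ v /ʷ] A) ≡ [ subW ρ v /ʷ] (subP σ (liftW ρ) A)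
    subP-[/ʷ] v A = subP-fusion (λ i → sym (subT-id (σ i))) e A
      where
      e : ∀ i → subW ρ ((v ▹ʷ wvar) i) ≡ subW (subW ρ v ▹ʷ wvar) (liftW ρ i)
      e zero    = refl
      e (suc j) = sym (trans (subW-∘ _ _ (ρ j)) (subW-id (ρ j)))

    [/ᵗ]-liftT : ∀ (t : Term n') A → [ t /ᵗ] (subP (liftT σ) ρ A) ≡ subP (t ▹ᵗ σ) ρ A
    [/ᵗ]-liftT t A = trans (subP-∘ _ _ _ _ A) (subP-cong e (λ i → subW-id (ρ i)) A)
      where
      e : ∀ i → subT (t ▹ᵗ var) (liftT σ i) ≡ (t ▹ᵗ σ) i
      e zero    = refl
      e (suc j) = trans (subT-∘ _ _ (σ j)) (subT-id (σ j))

    [/ʷ]-liftW : ∀ (v : World m') A → [ v /ʷ] (subP σ (liftW ρ) A) ≡ subP σ (v ▹ʷ ρ) A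
    [/ʷ]-liftW v A = trans (subP-∘ _ _ _ _ A) (subP-cong (λ i → subT-id (σ i)) e A)
      where
      e : ∀ i → subW (v ▹ʷ wvar) (liftW ρ i) ≡ (v ▹ʷ ρ) i
      e zero    = refl
      e (suc j) = trans (subW-∘ _ _ (ρ j)) (subW-id (ρ j))

    ▹ᵗ-wkJᵗ : ∀ (t : Term n') x → subJ (t ▹ᵗ σ) ρ (wkJᵗ x) ≡ subJ σ ρ x
    ▹ᵗ-wkJᵗ t (A ＠ w) = cong (_＠ subW ρ w) (subP-∘ _ _ _ _ A)

    ▹ʷ-wkJʷ : ∀ (v : World m') x → subJ σ (v ▹ʷ ρ) (wkJʷ x) ≡ subJ σ ρ x
    ▹ʷ-wkJʷ v (A ＠ w) = cong₂ _＠_ (subP-∘ _ _ _ _ A) (subW-∘ _ _ w)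

    ⊆-liftT : ∀ {Γ Γ'} → Γ ⊆[ subJ σ ρ ] Γ' → map wkJᵗ Γ ⊆[ subJ (liftT σ) ρ ] map wkJᵗ Γ'
    ⊆-liftT inc = ⊆-mapˡ (λ x → sym (wkJᵗ-subJ x)) (⊆-mapʳ (λ _ → refl) inc)

    ⊆-liftW : ∀ {Γ Γ'} → Γ ⊆[ subJ σ ρ ] Γ' → map wkJʷ Γ ⊆[ subJ σ (liftW ρ) ] map wkJʷ Γ'
    ⊆-liftW inc = ⊆-mapˡ (λ x → sym (wkJʷ-subJ x)) (⊆-mapʳ (λ _ → refl) inc)

    map-wkJᵗ-subJ : ∀ Δ → map (subJ (liftT σ) ρ) (map wkJᵗ Δ) ≡ map wkJᵗ (map (subJ σ ρ) Δ)
    map-wkJᵗ-subJ = map-square (λ x → sym (wkJᵗ-subJ x))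

    map-wkJʷ-subJ : ∀ Δ → map (subJ σ (liftW ρ)) (map wkJʷ Δ) ≡ map wkJʷ (map (subJ σ ρ) Δ)
    map-wkJʷ-subJ = map-square (λ x → sym (wkJʷ-subJ x))

    wk-split-liftT : ∀ Δ Δ₂ → map (subJ (liftT σ) ρ) (map wkJᵗ Δ) ++ map wkJᵗ Δ₂ ≡ map wkJᵗ (map (subJ σ ρ) Δ ++ Δ₂)
    wk-split-liftT Δ Δ₂ = trans (cong (_++ map wkJᵗ Δ₂) (map-wkJᵗ-subJ Δ)) (sym (List.map-++ wkJᵗ (map (subJ σ ρ) Δ) Δ₂))

    wk-split-liftW : ∀ Δ Δ₂ → map (subJ σ (liftW ρ)) (map wkJʷ Δ) ++ map wkJʷ Δ₂ ≡ map wkJʷ (map (subJ σ ρ) Δ ++ Δ₂)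
    wk-split-liftW Δ Δ₂ = trans (cong (_++ map wkJʷ Δ₂) (map-wkJʷ-subJ Δ)) (sym (List.map-++ wkJʷ (map (subJ σ ρ) Δ) Δ₂))

    wk-splitᵗ : ∀ Δ Δ₂ → map (subJ (wkT ∘ σ) ρ) Δ ++ map wkJᵗ Δ₂ ≡ map wkJᵗ (map (subJ σ ρ) Δ ++ Δ₂)
    wk-splitᵗ Δ Δ₂ = trans (cong (_++ map wkJᵗ Δ₂) (map-triangle (λ x → sym (wkJᵗ-subJ′ x)) Δ))
                           (sym (List.map-++ wkJᵗ (map (subJ σ ρ) Δ) Δ₂))

    wk-splitʷ : ∀ Δ Δ₂ → map (subJ σ (wkW ∘ ρ)) Δ ++ map wkJʷ Δ₂ ≡ map wkJʷ (map (subJ σ ρ) Δ ++ Δ₂)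
    wk-splitʷ Δ Δ₂ = trans (cong (_++ map wkJʷ Δ₂) (map-triangle (λ x → sym (wkJʷ-subJ′ x)) Δ))
                           (sym (List.map-++ wkJʷ (map (subJ σ ρ) Δ) Δ₂))

    wk-exposeᵗ : ∀ x {Δ Δ₂} → Δ ↭ subJ σ ρ x ∷ Δ₂ → map wkJᵗ Δ ↭ subJ (wkT ∘ σ) ρ x ∷ map wkJᵗ Δ₂
    wk-exposeᵗ x {Δ₂ = Δ₂} p = ↭-trans (map⁺ wkJᵗ p) (↭-reflexive (cong (_∷ map wkJᵗ Δ₂) (wkJᵗ-subJ′ x)))

    wk-exposeʷ : ∀ x {Δ Δ₂} → Δ ↭ subJ σ ρ x ∷ Δ₂ → map wkJʷ Δ ↭ subJ σ (wkW ∘ ρ) x ∷ map wkJʷ Δ₂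
    wk-exposeʷ x {Δ₂ = Δ₂} p = ↭-trans (map⁺ wkJʷ p) (↭-reflexive (cong (_∷ map wkJʷ Δ₂) (wkJʷ-subJ′ x)))

    lift-exposeᵗ : ∀ x {Δ Δ₂} → Δ ↭ subJ σ ρ x ∷ Δ₂ → map wkJᵗ Δ ↭ subJ (liftT σ) ρ (wkJᵗ x) ∷ map wkJᵗ Δ₂
    lift-exposeᵗ x {Δ₂ = Δ₂} p = ↭-trans (map⁺ wkJᵗ p) (↭-reflexive (cong (_∷ map wkJᵗ Δ₂) (wkJᵗ-subJ x)))

    lift-exposeʷ : ∀ x {Δ Δ₂} → Δ ↭ subJ σ ρ x ∷ Δ₂ → map wkJʷ Δ ↭ subJ σ (liftW ρ) (wkJʷ x) ∷ map wkJʷ Δ₂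
    lift-exposeʷ x {Δ₂ = Δ₂} p = ↭-trans (map⁺ wkJʷ p) (↭-reflexive (cong (_∷ map wkJʷ Δ₂) (wkJʷ-subJ x)))

  cast⟹ : ∀ {n m} {Γ Δ : Ctx n m} {J J'} → J ≡ J' → Γ ⨾ Δ ⟹ J → Γ ⨾ Δ ⟹ J'
  cast⟹ refl D = D

  head≡ : ∀ {n m} {A B : Prop n m} {w Δ} → A ≡ B → (A ＠ w) ∷ Δ ↭ (B ＠ w) ∷ Δ
  head≡ refl = ↭-refl

  sub⟹ : ∀ {n n' m m'} (σ : Fin n → Term n') (ρ : Fin m → World m') {Γ Δ : Ctx n m} {Γ' Ψ : Ctx n' m'} {J}
       → Γ ⊆[ subJ σ ρ ] Γ' → map (subJ σ ρ) Δ ↭ Ψ → Γ ⨾ Δ ⟹ J → Γ' ⨾ Ψ ⟹ subJ σ ρ J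
  sub⟹ σ ρ inc p init with ↭-singleton-inv (↭-sym p)
  ... | refl = init
  sub⟹ σ ρ inc p (copy x D)       = copy (inc x) (sub⟹ σ ρ inc (prep _ p) D)
  sub⟹ σ ρ inc p (⊗R {Δ₁ = Δ₁} {Δ₂ = Δ₂} D₁ D₂ q) =
    ⊗R (sub⟹ σ ρ inc ↭-refl D₁) (sub⟹ σ ρ inc ↭-refl D₂) (↭-trans (↭-sym p) (map⁺-++ (subJ σ ρ) {ys = Δ₁} {zs = Δ₂} q))
  sub⟹ σ ρ inc p (⊗L D q)         = ⊗L (sub⟹ σ ρ inc ↭-refl D) (↭-map-head (subJ σ ρ) p q)
  sub⟹ σ ρ inc p 𝟏R with ↭-empty-inv (↭-sym p)
  ... | refl = 𝟏R
  sub⟹ σ ρ inc p (𝟏L D q)         = 𝟏L (sub⟹ σ ρ inc ↭-refl D) (↭-map-head (subJ σ ρ) p q)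
  sub⟹ σ ρ inc p (⊸R D)           = ⊸R (sub⟹ σ ρ inc (prep _ p) D)
  sub⟹ σ ρ inc p (⊸L {Δ₁ = Δ₁} {Δ₂ = Δ₂} D₁ D₂ q) =
    ⊸L (sub⟹ σ ρ inc ↭-refl D₁) (sub⟹ σ ρ inc ↭-refl D₂)
       (↭-trans (↭-map-head (subJ σ ρ) p q) (prep _ (↭-reflexive (List.map-++ _ Δ₁ Δ₂))))
  sub⟹ σ ρ inc p ⊤R               = ⊤R
  sub⟹ σ ρ inc p (&R D₁ D₂)       = &R (sub⟹ σ ρ inc p D₁) (sub⟹ σ ρ inc p D₂)
  sub⟹ σ ρ inc p (&L₁ D q)        = &L₁ (sub⟹ σ ρ inc ↭-refl D) (↭-map-head (subJ σ ρ) p q)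
  sub⟹ σ ρ inc p (&L₂ D q)        = &L₂ (sub⟹ σ ρ inc ↭-refl D) (↭-map-head (subJ σ ρ) p q)
  sub⟹ σ ρ inc p (⊕R₁ D)          = ⊕R₁ (sub⟹ σ ρ inc p D)
  sub⟹ σ ρ inc p (⊕R₂ D)          = ⊕R₂ (sub⟹ σ ρ inc p D)
  sub⟹ σ ρ inc p (⊕L D₁ D₂ q)     = ⊕L (sub⟹ σ ρ inc ↭-refl D₁) (sub⟹ σ ρ inc ↭-refl D₂) (↭-map-head (subJ σ ρ) p q)
  sub⟹ σ ρ inc p (𝟎L q)           = 𝟎L (↭-map-head (subJ σ ρ) p q)
  sub⟹ σ ρ {Δ = Δ} inc p (∀ᵗR D)  =
    ∀ᵗR (sub⟹ (liftT σ) ρ (⊆-liftT σ ρ inc) (↭-trans (↭-reflexive (map-wkJᵗ-subJ σ ρ Δ)) (map⁺ wkJᵗ p)) D)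
  sub⟹ σ ρ {Δ = Δ} inc p (∀ʷR {w = w} D) =
    ∀ʷR (cast⟹ (cong (_ ＠_) (sym (wkW-subW σ ρ w)))
          (sub⟹ σ (liftW ρ) (⊆-liftW σ ρ inc) (↭-trans (↭-reflexive (map-wkJʷ-subJ σ ρ Δ)) (map⁺ wkJʷ p)) D))
  sub⟹ σ ρ inc p (∀ᵗL {A = A} t D q) = ∀ᵗL (subT σ t) (sub⟹ σ ρ inc (head≡ (subP-[/ᵗ] σ ρ t A)) D) (↭-map-head (subJ σ ρ) p q)
  sub⟹ σ ρ inc p (∀ʷL {A = A} v D q) = ∀ʷL (subW ρ v) (sub⟹ σ ρ inc (head≡ (subP-[/ʷ] σ ρ v A)) D) (↭-map-head (subJ σ ρ) p q)
  sub⟹ σ ρ inc p (∃ᵗR {A = A} t D)   = ∃ᵗR (subT σ t) (cast⟹ (cong (_＠ _) (subP-[/ᵗ] σ ρ t A)) (sub⟹ σ ρ inc p D))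
  sub⟹ σ ρ inc p (∃ʷR {A = A} v D)   = ∃ʷR (subW ρ v) (cast⟹ (cong (_＠ _) (subP-[/ʷ] σ ρ v A)) (sub⟹ σ ρ inc p D))
  sub⟹ σ ρ inc p (∃ᵗL {Δ = Δ₀} {J = J} D q) =
    ∃ᵗL (cast⟹ (sym (wkJᵗ-subJ σ ρ J)) (sub⟹ (liftT σ) ρ (⊆-liftT σ ρ inc) (prep _ (↭-reflexive (map-wkJᵗ-subJ σ ρ Δ₀))) D))
        (↭-map-head (subJ σ ρ) p q)
  sub⟹ σ ρ inc p (∃ʷL {u = u} {Δ = Δ₀} {J = J} D q) =
    ∃ʷL (cast⟹ (sym (wkJʷ-subJ σ ρ J))
          (sub⟹ σ (liftW ρ) (⊆-liftW σ ρ inc) (↭-reflexive (cong₂ _∷_ (cong (_ ＠_) (sym (wkW-subW σ ρ u))) (map-wkJʷ-subJ σ ρ Δ₀))) D))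
        (↭-map-head (subJ σ ρ) p q)
  sub⟹ σ ρ inc p (!R D) with ↭-empty-inv (↭-sym p)
  ... | refl = !R (sub⟹ σ ρ inc ↭-refl D)
  sub⟹ σ ρ inc p (!L D q)         = !L (sub⟹ σ ρ (⊆-∷ inc) ↭-refl D) (↭-map-head (subJ σ ρ) p q)
  sub⟹ σ ρ inc p (atR D)          = atR (sub⟹ σ ρ inc p D)
  sub⟹ σ ρ inc p (atL D q)        = atL (sub⟹ σ ρ inc ↭-refl D) (↭-map-head (subJ σ ρ) p q)
  sub⟹ σ ρ inc p (↓R {w = w} {A = A} D) = ↓R (cast⟹ (cong (_＠ _) (subP-[/ʷ] σ ρ w A)) (sub⟹ σ ρ inc p D))
  sub⟹ σ ρ inc p (↓L {v = v} {A = A} D q) = ↓L (sub⟹ σ ρ inc (head≡ (subP-[/ʷ] σ ρ v A)) D) (↭-map-head (subJ σ ρ) p q)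

  weaken⟹ : ∀ {n m} {Γ Γ' Δ Δ' : Ctx n m} {J} → Γ ⊆[ id ] Γ' → Δ ↭ Δ' → Γ ⨾ Δ ⟹ J → Γ' ⨾ Δ' ⟹ J
  weaken⟹ {Δ = Δ} {J = J} inc p D =
    cast⟹ (subJ-id J) (sub⟹ var wvar (⊆-subJ-id inc) (↭-trans (↭-reflexive (map-subJ-id Δ)) p) D)

  exch : ∀ {n m} {Γ Δ Δ' : Ctx n m} {J} → Γ ⨾ Δ ⟹ J → Δ ↭ Δ' → Γ ⨾ Δ' ⟹ J
  exch D p = weaken⟹ id p D

  wk⟹ᵗ : ∀ {n m} {Γ Δ : Ctx n m} {J} → Γ ⨾ Δ ⟹ J → map wkJᵗ Γ ⨾ map wkJᵗ Δ ⟹ wkJᵗ J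
  wk⟹ᵗ {Δ = Δ} {J} D =
    cast⟹ (wkJᵗ-as-subJ J)
          (sub⟹ (var ∘ suc) wvar (⊆-mapʳ (λ x → sym (wkJᵗ-as-subJ x)) id) (↭-reflexive (List.map-cong wkJᵗ-as-subJ Δ)) D)

  wk⟹ʷ : ∀ {n m} {Γ Δ : Ctx n m} {J} → Γ ⨾ Δ ⟹ J → map wkJʷ Γ ⨾ map wkJʷ Δ ⟹ wkJʷ J
  wk⟹ʷ {Δ = Δ} {J} D =
    cast⟹ (wkJʷ-as-subJ J)
          (sub⟹ var (wvar ∘ suc) (⊆-mapʳ (λ x → sym (wkJʷ-as-subJ x)) id) (↭-reflexive (List.map-cong wkJʷ-as-subJ Δ)) D)

  -- Substitution of a proof for a hypothesis in natural deduction, derived by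
  -- discharging the hypothesis with ⊸ and moving the conclusion to u with at.
  ndCut : ∀ {n m} {Γ Δ Δ₁ Δ₂ : Ctx n m} {A u J}
        → Γ ⨾ Δ₁ ⊢ A ＠ u → Γ ⨾ (A ＠ u) ∷ Δ₂ ⊢ J → Δ ↭ Δ₁ ++ Δ₂ → Γ ⨾ Δ ⊢ J
  ndCut {Δ₁ = Δ₁} {Δ₂} {J = C ＠ w} D E p = atE (⊸E (⊸I (atI E)) D (↭-trans p (++-comm Δ₁ Δ₂)))

  soundness : ∀ {n m} {Γ Δ : Ctx n m} {J} → Γ ⨾ Δ ⟹ J → Γ ⨾ Δ ⊢ J
  soundness init           = hyp
  soundness (copy x D)     = ndCut (hyp! x) (soundness D) ↭-refl
  soundness (⊗R D₁ D₂ q)   = ⊗I (soundness D₁) (soundness D₂) q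
  soundness (⊗L D q)       = ⊗E hyp (soundness D) q
  soundness 𝟏R             = 𝟏I
  soundness (𝟏L D q)       = 𝟏E hyp (soundness D) q
  soundness (⊸R D)         = ⊸I (soundness D)
  soundness (⊸L D₁ D₂ q)   = ndCut (⊸E hyp (soundness D₁) ↭-refl) (soundness D₂) q
  soundness ⊤R             = ⊤I
  soundness (&R D₁ D₂)     = &I (soundness D₁) (soundness D₂)
  soundness (&L₁ D q)      = ndCut (&E₁ hyp) (soundness D) q
  soundness (&L₂ D q)      = ndCut (&E₂ hyp) (soundness D) q
  soundness (⊕R₁ D)        = ⊕I₁ (soundness D)
  soundness (⊕R₂ D)        = ⊕I₂ (soundness D)
  soundness (⊕L D₁ D₂ q)   = ⊕E hyp (soundness D₁) (soundness D₂) q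
  soundness (𝟎L q)         = 𝟎E hyp q
  soundness (∀ᵗR D)        = ∀ᵗI (soundness D)
  soundness (∀ʷR D)        = ∀ʷI (soundness D)
  soundness (∀ᵗL t D q)    = ndCut (∀ᵗE t hyp) (soundness D) q
  soundness (∀ʷL v D q)    = ndCut (∀ʷE v hyp) (soundness D) q
  soundness (∃ᵗR t D)      = ∃ᵗI t (soundness D)
  soundness (∃ʷR v D)      = ∃ʷI v (soundness D)
  soundness (∃ᵗL D q)      = ∃ᵗE hyp (soundness D) q
  soundness (∃ʷL D q)      = ∃ʷE hyp (soundness D) q
  soundness (!R D)         = !I (soundness D)
  soundness (!L D q)       = !E hyp (soundness D) q
  soundness (atR D)        = atI (soundness D)
  soundness (atL D q)      = ndCut (atE hyp) (soundness D) q
  soundness (↓R D)         = ↓I (soundness D)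
  soundness (↓L D q)       = ndCut (↓E hyp) (soundness D) q

  -- Identity expansion: every substitution instance of A, hence A itself,
  -- entails itself.  Generalising over substitutions makes the ↓ case an
  -- instance of the induction hypothesis.
  identity-sub : ∀ {n n' m m'} (A : Prop n m) (σ : Fin n → Term n') (ρ : Fin m → World m') {Γ u}
               → Γ ⨾ [ subP σ ρ A ＠ u ] ⟹ subP σ ρ A ＠ u
  identity-sub (atom p ts) σ ρ = init
  identity-sub (A ⊗ B) σ ρ     = ⊗L (⊗R (identity-sub A σ ρ) (identity-sub B σ ρ) ↭-refl) ↭-refl
  identity-sub (A ⊸ B) σ ρ     = ⊸R (⊸L (identity-sub A σ ρ) (identity-sub B σ ρ) (swap _ _ ↭-refl))
  identity-sub (A & B) σ ρ     = &R (&L₁ (identity-sub A σ ρ) ↭-refl) (&L₂ (identity-sub B σ ρ) ↭-refl)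
  identity-sub (A ⊕ B) σ ρ     = ⊕L (⊕R₁ (identity-sub A σ ρ)) (⊕R₂ (identity-sub B σ ρ)) ↭-refl
  identity-sub 𝟏 σ ρ           = 𝟏L 𝟏R ↭-refl
  identity-sub ⊤ σ ρ           = ⊤R
  identity-sub 𝟎 σ ρ           = 𝟎L ↭-refl
  identity-sub (! A) σ ρ       = !L (!R (copy (here refl) (identity-sub A σ ρ))) ↭-refl
  identity-sub (Allᵗ A) σ ρ    =
    ∀ᵗR (∀ᵗL (var zero) (exch (identity-sub A (liftT σ) ρ) (head≡ (sym (open-fresh-ᵗ _)))) ↭-refl)
  identity-sub (Exᵗ A) σ ρ     =
    ∃ᵗL (∃ᵗR (var zero) (cast⟹ (cong (_＠ _) (sym (open-fresh-ᵗ _))) (identity-sub A (liftT σ) ρ))) ↭-refl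
  identity-sub (A at w) σ ρ    = atL (atR (identity-sub A σ ρ)) ↭-refl
  identity-sub (Down A) σ ρ {Γ} {u} =
    ↓L (↓R (subst (λ X → Γ ⨾ [ X ＠ u ] ⟹ X ＠ u) (sym ([/ʷ]-liftW σ ρ u A)) (identity-sub A σ (u ▹ʷ ρ)))) ↭-refl
  identity-sub (Allʷ A) σ ρ    =
    ∀ʷR (∀ʷL (wvar zero) (exch (identity-sub A σ (liftW ρ)) (head≡ (sym (open-fresh-ʷ _)))) ↭-refl)
  identity-sub (Exʷ A) σ ρ     =
    ∃ʷL (∃ʷR (wvar zero) (cast⟹ (cong (_＠ _) (sym (open-fresh-ʷ _))) (identity-sub A σ (liftW ρ)))) ↭-refl

  identity : ∀ {n m} {Γ : Ctx n m} A u → Γ ⨾ [ A ＠ u ] ⟹ A ＠ u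
  identity {Γ = Γ} A u = subst (λ X → Γ ⨾ [ X ＠ u ] ⟹ X ＠ u) (subP-id A) (identity-sub A var wvar)

  instantiateᵗ : ∀ {n m} {Γ Δ : Ctx n m} {X J} (t : Term n)
               → map wkJᵗ Γ ⨾ X ∷ map wkJᵗ Δ ⟹ wkJᵗ J → Γ ⨾ subJ (t ▹ᵗ var) wvar X ∷ Δ ⟹ J
  instantiateᵗ {Δ = Δ} {J = J} t E =
    cast⟹ (fresh J) (sub⟹ (t ▹ᵗ var) wvar (⊆-mapˡ fresh id) (prep _ (↭-reflexive (map-cancel fresh Δ))) E)
    where
    fresh : ∀ x → subJ (t ▹ᵗ var) wvar (wkJᵗ x) ≡ x
    fresh x = trans (▹ᵗ-wkJᵗ var wvar t x) (subJ-id x)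

  instantiateʷ : ∀ {n m} {Γ Δ : Ctx n m} {X J} (v : World m)
               → map wkJʷ Γ ⨾ X ∷ map wkJʷ Δ ⟹ wkJʷ J → Γ ⨾ subJ var (v ▹ʷ wvar) X ∷ Δ ⟹ J
  instantiateʷ {Δ = Δ} {J = J} v E =
    cast⟹ (fresh J) (sub⟹ var (v ▹ʷ wvar) (⊆-mapˡ fresh id) (prep _ (↭-reflexive (map-cancel fresh Δ))) E)
    where
    fresh : ∀ x → subJ var (v ▹ʷ wvar) (wkJʷ x) ≡ x
    fresh x = trans (▹ʷ-wkJʷ var wvar v x) (subJ-id x)

  -- The size of a proposition bounds the induction in cut elimination; it is
  -- invariant under substitution, so instantiating quantifiers decreases it.
  size : ∀ {n m} → Prop n m → ℕ
  size (atom p ts) = 1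
  size (A ⊗ B)     = suc (size A + size B)
  size (A ⊸ B)     = suc (size A + size B)
  size (A & B)     = suc (size A + size B)
  size (A ⊕ B)     = suc (size A + size B)
  size 𝟏           = 1
  size ⊤           = 1
  size 𝟎           = 1
  size (! A)       = suc (size A)
  size (Allᵗ A)    = suc (size A)
  size (Exᵗ A)     = suc (size A)
  size (A at w)    = suc (size A)
  size (Down A)    = suc (size A)
  size (Allʷ A)    = suc (size A)
  size (Exʷ A)     = suc (size A)

  size-subP : ∀ {n n' m m'} (σ : Fin n → Term n') (ρ : Fin m → World m') A → size (subP σ ρ A) ≡ size A
  size-subP σ ρ (atom p ts) = refl
  size-subP σ ρ (A ⊗ B)     = cong₂ (λ a b → suc (a + b)) (size-subP σ ρ A) (size-subP σ ρ B)
  size-subP σ ρ (A ⊸ B)     = cong₂ (λ a b → suc (a + b)) (size-subP σ ρ A) (size-subP σ ρ B)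
  size-subP σ ρ (A & B)     = cong₂ (λ a b → suc (a + b)) (size-subP σ ρ A) (size-subP σ ρ B)
  size-subP σ ρ (A ⊕ B)     = cong₂ (λ a b → suc (a + b)) (size-subP σ ρ A) (size-subP σ ρ B)
  size-subP σ ρ 𝟏           = refl
  size-subP σ ρ ⊤           = refl
  size-subP σ ρ 𝟎           = refl
  size-subP σ ρ (! A)       = cong suc (size-subP σ ρ A)
  size-subP σ ρ (Allᵗ A)    = cong suc (size-subP _ ρ A)
  size-subP σ ρ (Exᵗ A)     = cong suc (size-subP _ ρ A)
  size-subP σ ρ (A at w)    = cong suc (size-subP σ ρ A)
  size-subP σ ρ (Down A)    = cong suc (size-subP σ _ A)
  size-subP σ ρ (Allʷ A)    = cong suc (size-subP σ _ A)
  size-subP σ ρ (Exʷ A)     = cong suc (size-subP σ _ A)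

  size-subP≤ : ∀ {n n' m m' k} (σ : Fin n → Term n') (ρ : Fin m → World m') A → size A ≤ k → size (subP σ ρ A) ≤ k
  size-subP≤ σ ρ A le = ≤-trans (≤-reflexive (size-subP σ ρ A)) le

  EndsRight : ∀ {n m} {Γ Δ : Ctx n m} {J} → Γ ⨾ Δ ⟹ J → Set
  EndsRight (copy _ _)    = ⊥
  EndsRight (⊗L _ _)      = ⊥
  EndsRight (𝟏L _ _)      = ⊥
  EndsRight (⊸L _ _ _)    = ⊥
  EndsRight (&L₁ _ _)     = ⊥
  EndsRight (&L₂ _ _)     = ⊥
  EndsRight (⊕L _ _ _)    = ⊥
  EndsRight (𝟎L _)        = ⊥
  EndsRight (∀ᵗL _ _ _)   = ⊥
  EndsRight (∀ʷL _ _ _)   = ⊥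
  EndsRight (∃ᵗL _ _)     = ⊥
  EndsRight (∃ʷL _ _)     = ⊥
  EndsRight (!L _ _)      = ⊥
  EndsRight (atL _ _)     = ⊥
  EndsRight (↓L _ _)      = ⊥
  EndsRight _             = Unit

  data LeftPremises {n m} (Γ : Ctx n m) : Jdg n m → Ctx n m → Jdg n m → Set c where
    ⊗ₚ  : ∀ {A B u Δ J} → Γ ⨾ (A ＠ u) ∷ (B ＠ u) ∷ Δ ⟹ J → LeftPremises Γ (A ⊗ B ＠ u) Δ J
    𝟏ₚ  : ∀ {u Δ J} → Γ ⨾ Δ ⟹ J → LeftPremises Γ (𝟏 ＠ u) Δ J
    ⊸ₚ  : ∀ {A B u Δ₁ Δ₂ J} → Γ ⨾ Δ₁ ⟹ A ＠ u → Γ ⨾ (B ＠ u) ∷ Δ₂ ⟹ J → LeftPremises Γ (A ⊸ B ＠ u) (Δ₁ ++ Δ₂) J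
    &₁ₚ : ∀ {A B u Δ J} → Γ ⨾ (A ＠ u) ∷ Δ ⟹ J → LeftPremises Γ (A & B ＠ u) Δ J
    &₂ₚ : ∀ {A B u Δ J} → Γ ⨾ (B ＠ u) ∷ Δ ⟹ J → LeftPremises Γ (A & B ＠ u) Δ J
    ⊕ₚ  : ∀ {A B u Δ J} → Γ ⨾ (A ＠ u) ∷ Δ ⟹ J → Γ ⨾ (B ＠ u) ∷ Δ ⟹ J → LeftPremises Γ (A ⊕ B ＠ u) Δ J
    𝟎ₚ  : ∀ {u Δ J} → LeftPremises Γ (𝟎 ＠ u) Δ J
    ∀ᵗₚ : ∀ {A u Δ J} (t : Term n) → Γ ⨾ ([ t /ᵗ] A ＠ u) ∷ Δ ⟹ J → LeftPremises Γ (Allᵗ A ＠ u) Δ J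
    ∀ʷₚ : ∀ {A u Δ J} (v : World m) → Γ ⨾ ([ v /ʷ] A ＠ u) ∷ Δ ⟹ J → LeftPremises Γ (Allʷ A ＠ u) Δ J
    ∃ᵗₚ : ∀ {A u Δ J} → map wkJᵗ Γ ⨾ (A ＠ u) ∷ map wkJᵗ Δ ⟹ wkJᵗ J → LeftPremises Γ (Exᵗ A ＠ u) Δ J
    ∃ʷₚ : ∀ {A u Δ J} → map wkJʷ Γ ⨾ (A ＠ wkW u) ∷ map wkJʷ Δ ⟹ wkJʷ J → LeftPremises Γ (Exʷ A ＠ u) Δ J
    !ₚ  : ∀ {A u Δ J} → (A ＠ u) ∷ Γ ⨾ Δ ⟹ J → LeftPremises Γ (! A ＠ u) Δ J
    atₚ : ∀ {A u v Δ J} → Γ ⨾ (A ＠ u) ∷ Δ ⟹ J → LeftPremises Γ ((A at u) ＠ v) Δ J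
    ↓ₚ  : ∀ {A v Δ J} → Γ ⨾ ([ v /ʷ] A ＠ v) ∷ Δ ⟹ J → LeftPremises Γ (Down A ＠ v) Δ J

  mutual
    -- Cut into a linear hypothesis: first commute with a left rule ending D.
    cut : ∀ k {n m n' m'} {Γ Δ₁ : Ctx n m} {A : Prop n m} {u : World m} → size A ≤ k → (D : Γ ⨾ Δ₁ ⟹ A ＠ u)
        → (σ : Fin n → Term n') (ρ : Fin m → World m') {Γ' : Ctx n' m'} → Γ ⊆[ subJ σ ρ ] Γ'
        → ∀ {Δ Δ₂ J} → Γ' ⨾ Δ ⟹ J → Δ ↭ subJ σ ρ (A ＠ u) ∷ Δ₂ → Γ' ⨾ map (subJ σ ρ) Δ₁ ++ Δ₂ ⟹ J
    cut k le D@init σ ρ inc E p       = cutR k le D _ σ ρ inc E p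
    cut k le (copy x D) σ ρ inc E p   = copy (inc x) (cut k le D σ ρ inc E p)
    cut k le D@(⊗R _ _ _) σ ρ inc E p = cutR k le D _ σ ρ inc E p
    cut k le (⊗L D q) σ ρ inc E p     = ⊗L (cut k le D σ ρ inc E p) (++⁺ʳ _ (map⁺ (subJ σ ρ) q))
    cut k le D@𝟏R σ ρ inc E p         = cutR k le D _ σ ρ inc E p
    cut k le (𝟏L D q) σ ρ inc E p     = 𝟏L (cut k le D σ ρ inc E p) (++⁺ʳ _ (map⁺ (subJ σ ρ) q))
    cut k le D@(⊸R _) σ ρ inc E p     = cutR k le D _ σ ρ inc E p
    cut k le (⊸L {Δ₁ = Δa} {Δ₂ = Δb} D₁ D₂ q) σ ρ inc {Δ₂ = Δ₂} E p =
      ⊸L (sub⟹ σ ρ inc ↭-refl D₁) (cut k le D₂ σ ρ inc E p)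
         (↭-trans (++⁺ʳ _ (map⁺ (subJ σ ρ) q))
                  (prep _ (↭-reflexive (trans (cong (_++ Δ₂) (List.map-++ _ Δa Δb)) (List.++-assoc (map (subJ σ ρ) Δa) _ Δ₂)))))
    cut k le D@⊤R σ ρ inc E p         = cutR k le D _ σ ρ inc E p
    cut k le D@(&R _ _) σ ρ inc E p   = cutR k le D _ σ ρ inc E p
    cut k le (&L₁ D q) σ ρ inc E p    = &L₁ (cut k le D σ ρ inc E p) (++⁺ʳ _ (map⁺ (subJ σ ρ) q))
    cut k le (&L₂ D q) σ ρ inc E p    = &L₂ (cut k le D σ ρ inc E p) (++⁺ʳ _ (map⁺ (subJ σ ρ) q))
    cut k le D@(⊕R₁ _) σ ρ inc E p    = cutR k le D _ σ ρ inc E p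
    cut k le D@(⊕R₂ _) σ ρ inc E p    = cutR k le D _ σ ρ inc E p
    cut k le (⊕L D₁ D₂ q) σ ρ inc E p = ⊕L (cut k le D₁ σ ρ inc E p) (cut k le D₂ σ ρ inc E p) (++⁺ʳ _ (map⁺ (subJ σ ρ) q))
    cut k le (𝟎L q) σ ρ inc E p       = 𝟎L (++⁺ʳ _ (map⁺ (subJ σ ρ) q))
    cut k le D@(∀ᵗR _) σ ρ inc E p    = cutR k le D _ σ ρ inc E p
    cut k le D@(∀ʷR _) σ ρ inc E p    = cutR k le D _ σ ρ inc E p
    cut k le (∀ᵗL {A = X} t D q) σ ρ inc E p =
      ∀ᵗL (subT σ t) (exch (cut k le D σ ρ inc E p) (head≡ (subP-[/ᵗ] σ ρ t X))) (++⁺ʳ _ (map⁺ (subJ σ ρ) q))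
    cut k le (∀ʷL {A = X} v D q) σ ρ inc E p =
      ∀ʷL (subW ρ v) (exch (cut k le D σ ρ inc E p) (head≡ (subP-[/ʷ] σ ρ v X))) (++⁺ʳ _ (map⁺ (subJ σ ρ) q))
    cut k le D@(∃ᵗR _ _) σ ρ inc E p  = cutR k le D _ σ ρ inc E p
    cut k le D@(∃ʷR _ _) σ ρ inc E p  = cutR k le D _ σ ρ inc E p
    cut k {A = A} {u = u} le (∃ᵗL {Δ = Δ₀} D q) σ ρ inc {Δ₂ = Δ₂} E p =
      ∃ᵗL (exch (cut k (size-subP≤ _ _ A le) D (liftT σ) ρ (⊆-liftT σ ρ inc) (wk⟹ᵗ E)
                     (lift-exposeᵗ σ ρ (A ＠ u) p))
                (prep _ (↭-reflexive (wk-split-liftT σ ρ Δ₀ Δ₂))))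
          (++⁺ʳ _ (map⁺ (subJ σ ρ) q))
    cut k {A = A} {u = u} le (∃ʷL {u = v} {Δ = Δ₀} D q) σ ρ inc {Δ₂ = Δ₂} E p =
      ∃ʷL (exch (cut k (size-subP≤ _ _ A le) D σ (liftW ρ) (⊆-liftW σ ρ inc) (wk⟹ʷ E)
                     (lift-exposeʷ σ ρ (A ＠ u) p))
                (↭-reflexive (cong₂ _∷_ (cong (_ ＠_) (sym (wkW-subW σ ρ v))) (wk-split-liftW σ ρ Δ₀ Δ₂))))
          (++⁺ʳ _ (map⁺ (subJ σ ρ) q))
    cut k le D@(!R _) σ ρ inc E p     = cutR k le D _ σ ρ inc E p
    cut k le (!L D q) σ ρ inc E p     = !L (cut k le D σ ρ (⊆-∷ inc) (weaken⟹ there ↭-refl E) p) (++⁺ʳ _ (map⁺ (subJ σ ρ) q))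
    cut k le D@(atR _) σ ρ inc E p    = cutR k le D _ σ ρ inc E p
    cut k le (atL D q) σ ρ inc E p    = atL (cut k le D σ ρ inc E p) (++⁺ʳ _ (map⁺ (subJ σ ρ) q))
    cut k le D@(↓R _) σ ρ inc E p     = cutR k le D _ σ ρ inc E p
    cut k le (↓L {v = v} {A = X} D q) σ ρ inc E p =
      ↓L (exch (cut k le D σ ρ inc E p) (head≡ (subP-[/ʷ] σ ρ v X))) (++⁺ʳ _ (map⁺ (subJ σ ρ) q))

    -- D ends on the right: commute with the last rule of E unless that rule
    -- decomposes the cut formula itself.
    cutR : ∀ k {n m n' m'} {Γ Δ₁ : Ctx n m} {A : Prop n m} {u : World m} → size A ≤ k → (D : Γ ⨾ Δ₁ ⟹ A ＠ u) → EndsRight D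
         → (σ : Fin n → Term n') (ρ : Fin m → World m') {Γ' : Ctx n' m'} → Γ ⊆[ subJ σ ρ ] Γ'
         → ∀ {Δ Δ₂ J} → Γ' ⨾ Δ ⟹ J → Δ ↭ subJ σ ρ (A ＠ u) ∷ Δ₂ → Γ' ⨾ map (subJ σ ρ) Δ₁ ++ Δ₂ ⟹ J
    cutR k le D r σ ρ inc init p with List.∷-injective (↭-singleton-inv (↭-sym p))
    ... | e , refl = cast⟹ e (sub⟹ σ ρ inc (↭-reflexive (sym (List.++-identityʳ _))) D)
    cutR k le D r σ ρ inc (copy x E) p = copy x (cutR₁ k le D r σ ρ inc E p)
    cutR k {Δ₁ = Δ₁} le D r σ ρ inc (⊗R {Δ₁ = Δa} {Δ₂ = Δb} E₁ E₂ q) p with ↭-++-inv Δa (↭-trans (↭-sym p) q)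
    ... | inj₁ (a , qa , r') =
      ⊗R (cutR k le D r σ ρ inc E₁ qa) E₂ (↭-trans (++⁺ˡ _ r') (↭-reflexive (sym (List.++-assoc (map (subJ σ ρ) Δ₁) a Δb))))
    ... | inj₂ (b , qb , r') = ⊗R E₁ (cutR k le D r σ ρ inc E₂ qb) (↭-trans (++⁺ˡ _ r') (shifts (map (subJ σ ρ) Δ₁) Δa))
    cutR k le D r σ ρ inc 𝟏R p         = ⊥-elim (¬x∷xs↭[] (↭-sym p))
    cutR k le D r σ ρ inc (⊸R E) p     = ⊸R (cutR₁ k le D r σ ρ inc E p)
    cutR k le D r σ ρ inc ⊤R p         = ⊤R
    cutR k le D r σ ρ inc (&R E₁ E₂) p = &R (cutR k le D r σ ρ inc E₁ p) (cutR k le D r σ ρ inc E₂ p)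
    cutR k le D r σ ρ inc (⊕R₁ E) p    = ⊕R₁ (cutR k le D r σ ρ inc E p)
    cutR k le D r σ ρ inc (⊕R₂ E) p    = ⊕R₂ (cutR k le D r σ ρ inc E p)
    cutR k {Δ₁ = Δ₁} {A = A} {u = u} le D r σ ρ inc {Δ₂ = Δ₂} (∀ᵗR E) p =
      ∀ᵗR (exch (cutR k le D r (wkT ∘ σ) ρ (⊆-mapʳ (wkJᵗ-subJ′ σ ρ) inc) E
                      (wk-exposeᵗ σ ρ (A ＠ u) p))
                (↭-reflexive (wk-splitᵗ σ ρ Δ₁ Δ₂)))
    cutR k {Δ₁ = Δ₁} {A = A} {u = u} le D r σ ρ inc {Δ₂ = Δ₂} (∀ʷR E) p =
      ∀ʷR (exch (cutR k le D r σ (wkW ∘ ρ) (⊆-mapʳ (wkJʷ-subJ′ σ ρ) inc) E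
                      (wk-exposeʷ σ ρ (A ＠ u) p))
                (↭-reflexive (wk-splitʷ σ ρ Δ₁ Δ₂)))
    cutR k le D r σ ρ inc (∃ᵗR t E) p  = ∃ᵗR t (cutR k le D r σ ρ inc E p)
    cutR k le D r σ ρ inc (∃ʷR v E) p  = ∃ʷR v (cutR k le D r σ ρ inc E p)
    cutR k le D r σ ρ inc (!R E) p     = ⊥-elim (¬x∷xs↭[] (↭-sym p))
    cutR k le D r σ ρ inc (atR E) p    = atR (cutR k le D r σ ρ inc E p)
    cutR k le D r σ ρ inc (↓R E) p     = ↓R (cutR k le D r σ ρ inc E p)
    cutR k {Δ₁ = Δ₁} le D r σ ρ inc (⊗L {A = X} {u = v} {B = Y} E q) p with ↭-∷-inv (↭-trans (↭-sym q) p)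
    ... | inj₁ (e , b) = viaPrincipal k le D r σ ρ inc e (⊗ₚ E) b
    ... | inj₂ (zs , a , b) =
      ⊗L (exch (cutR k le D r σ ρ inc E (↭-under₂ _ _ a)) (shifts (map (subJ σ ρ) Δ₁) ((X ＠ v) ∷ (Y ＠ v) ∷ []))) (↭-behind _ b)
    cutR k le D r σ ρ inc (𝟏L E q) p with ↭-∷-inv (↭-trans (↭-sym q) p)
    ... | inj₁ (e , b) = viaPrincipal k le D r σ ρ inc e (𝟏ₚ E) b
    ... | inj₂ (zs , a , b) = 𝟏L (cutR k le D r σ ρ inc E a) (↭-behind _ b)
    cutR k {Δ₁ = Δ₁} le D r σ ρ inc (⊸L {Δ₁ = Δa} {Δ₂ = Δb} E₁ E₂ q) p with ↭-∷-inv (↭-trans (↭-sym q) p)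
    ... | inj₁ (e , b) = viaPrincipal k le D r σ ρ inc e (⊸ₚ E₁ E₂) b
    ... | inj₂ (zs , a , b) with ↭-++-inv Δa (↭-sym a)
    ...   | inj₁ (a' , qa , r') =
      ⊸L (cutR k le D r σ ρ inc E₁ qa) E₂
         (↭-trans (↭-behind _ b) (prep _ (↭-trans (++⁺ˡ _ r') (↭-reflexive (sym (List.++-assoc (map (subJ σ ρ) Δ₁) a' Δb))))))
    ...   | inj₂ (b' , qb , r') =
      ⊸L E₁ (cutR₁ k le D r σ ρ inc E₂ qb)
         (↭-trans (↭-behind _ b) (prep _ (↭-trans (++⁺ˡ _ r') (shifts (map (subJ σ ρ) Δ₁) Δa))))
    cutR k le D r σ ρ inc (&L₁ E q) p with ↭-∷-inv (↭-trans (↭-sym q) p)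
    ... | inj₁ (e , b) = viaPrincipal k le D r σ ρ inc e (&₁ₚ E) b
    ... | inj₂ (zs , a , b) = &L₁ (cutR₁ k le D r σ ρ inc E a) (↭-behind _ b)
    cutR k le D r σ ρ inc (&L₂ E q) p with ↭-∷-inv (↭-trans (↭-sym q) p)
    ... | inj₁ (e , b) = viaPrincipal k le D r σ ρ inc e (&₂ₚ E) b
    ... | inj₂ (zs , a , b) = &L₂ (cutR₁ k le D r σ ρ inc E a) (↭-behind _ b)
    cutR k le D r σ ρ inc (⊕L E₁ E₂ q) p with ↭-∷-inv (↭-trans (↭-sym q) p)
    ... | inj₁ (e , b) = viaPrincipal k le D r σ ρ inc e (⊕ₚ E₁ E₂) b
    ... | inj₂ (zs , a , b) = ⊕L (cutR₁ k le D r σ ρ inc E₁ a) (cutR₁ k le D r σ ρ inc E₂ a) (↭-behind _ b)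
    cutR k le D r σ ρ inc (𝟎L q) p with ↭-∷-inv (↭-trans (↭-sym q) p)
    ... | inj₁ (e , b) = viaPrincipal k le D r σ ρ inc e 𝟎ₚ b
    ... | inj₂ (zs , a , b) = 𝟎L (↭-behind _ b)
    cutR k le D r σ ρ inc (∀ᵗL t E q) p with ↭-∷-inv (↭-trans (↭-sym q) p)
    ... | inj₁ (e , b) = viaPrincipal k le D r σ ρ inc e (∀ᵗₚ t E) b
    ... | inj₂ (zs , a , b) = ∀ᵗL t (cutR₁ k le D r σ ρ inc E a) (↭-behind _ b)
    cutR k le D r σ ρ inc (∀ʷL v E q) p with ↭-∷-inv (↭-trans (↭-sym q) p)
    ... | inj₁ (e , b) = viaPrincipal k le D r σ ρ inc e (∀ʷₚ v E) b
    ... | inj₂ (zs , a , b) = ∀ʷL v (cutR₁ k le D r σ ρ inc E a) (↭-behind _ b)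
    cutR k {Δ₁ = Δ₁} {A = A} {u = u} le D r σ ρ inc (∃ᵗL E q) p with ↭-∷-inv (↭-trans (↭-sym q) p)
    ... | inj₁ (e , b) = viaPrincipal k le D r σ ρ inc e (∃ᵗₚ E) b
    ... | inj₂ (zs , a , b) =
      ∃ᵗL (exch (cutR₁ k le D r (wkT ∘ σ) ρ (⊆-mapʳ (wkJᵗ-subJ′ σ ρ) inc) E
                       (wk-exposeᵗ σ ρ (A ＠ u) a))
                (prep _ (↭-reflexive (wk-splitᵗ σ ρ Δ₁ zs))))
          (↭-behind _ b)
    cutR k {Δ₁ = Δ₁} {A = A} {u = u} le D r σ ρ inc (∃ʷL E q) p with ↭-∷-inv (↭-trans (↭-sym q) p)
    ... | inj₁ (e , b) = viaPrincipal k le D r σ ρ inc e (∃ʷₚ E) b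
    ... | inj₂ (zs , a , b) =
      ∃ʷL (exch (cutR₁ k le D r σ (wkW ∘ ρ) (⊆-mapʳ (wkJʷ-subJ′ σ ρ) inc) E
                       (wk-exposeʷ σ ρ (A ＠ u) a))
                (prep _ (↭-reflexive (wk-splitʷ σ ρ Δ₁ zs))))
          (↭-behind _ b)
    cutR k le D r σ ρ inc (!L E q) p with ↭-∷-inv (↭-trans (↭-sym q) p)
    ... | inj₁ (e , b) = viaPrincipal k le D r σ ρ inc e (!ₚ E) b
    ... | inj₂ (zs , a , b) = !L (cutR k le D r σ ρ (there ∘ inc) E a) (↭-behind _ b)
    cutR k le D r σ ρ inc (atL E q) p with ↭-∷-inv (↭-trans (↭-sym q) p)
    ... | inj₁ (e , b) = viaPrincipal k le D r σ ρ inc e (atₚ E) b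
    ... | inj₂ (zs , a , b) = atL (cutR₁ k le D r σ ρ inc E a) (↭-behind _ b)
    cutR k le D r σ ρ inc (↓L E q) p with ↭-∷-inv (↭-trans (↭-sym q) p)
    ... | inj₁ (e , b) = viaPrincipal k le D r σ ρ inc e (↓ₚ E) b
    ... | inj₂ (zs , a , b) = ↓L (cutR₁ k le D r σ ρ inc E a) (↭-behind _ b)

    cutR₁ : ∀ k {n m n' m'} {Γ Δ₁ : Ctx n m} {A : Prop n m} {u : World m} → size A ≤ k → (D : Γ ⨾ Δ₁ ⟹ A ＠ u) → EndsRight D
          → (σ : Fin n → Term n') (ρ : Fin m → World m') {Γ' : Ctx n' m'} → Γ ⊆[ subJ σ ρ ] Γ'
          → ∀ {X Δ Δ₂ J} → Γ' ⨾ X ∷ Δ ⟹ J → Δ ↭ subJ σ ρ (A ＠ u) ∷ Δ₂ → Γ' ⨾ X ∷ (map (subJ σ ρ) Δ₁ ++ Δ₂) ⟹ J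
    cutR₁ k {Δ₁ = Δ₁} le D r σ ρ inc E p = exch (cutR k le D r σ ρ inc E (↭-under _ p)) (shift _ (map (subJ σ ρ) Δ₁) _)

    viaPrincipal : ∀ k {n m n' m'} {Γ Δ₁ : Ctx n m} {A : Prop n m} {u : World m} → size A ≤ k → (D : Γ ⨾ Δ₁ ⟹ A ＠ u) → EndsRight D
                 → (σ : Fin n → Term n') (ρ : Fin m → World m') {Γ' : Ctx n' m'} → Γ ⊆[ subJ σ ρ ] Γ'
                 → ∀ {C Δ Δ₂ J} → C ≡ subJ σ ρ (A ＠ u) → LeftPremises Γ' C Δ J → Δ ↭ Δ₂
                 → Γ' ⨾ map (subJ σ ρ) Δ₁ ++ Δ₂ ⟹ J
    viaPrincipal k le D r σ ρ inc refl P b = exch (principal k le D r σ ρ inc P) (++⁺ˡ _ b)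

    -- Principal reductions: the cut is replaced by cuts on smaller formulas.
    principal : ∀ k {n m n' m'} {Γ Δ₁ : Ctx n m} {A : Prop n m} {u : World m} → size A ≤ k → (D : Γ ⨾ Δ₁ ⟹ A ＠ u) → EndsRight D
              → (σ : Fin n → Term n') (ρ : Fin m → World m') {Γ' : Ctx n' m'} → Γ ⊆[ subJ σ ρ ] Γ'
              → ∀ {Δ J} → LeftPremises Γ' (subJ σ ρ (A ＠ u)) Δ J → Γ' ⨾ map (subJ σ ρ) Δ₁ ++ Δ ⟹ J
    principal (suc k) (s≤s le) (⊗R {Δ₁ = Δa} {A = A₁} {Δ₂ = Δb} D₁ D₂ q) _ σ ρ inc {Δ} (⊗ₚ E) =
      exch (cut k (m+n≤o⇒m≤o (size A₁) le) D₁ σ ρ inc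
                (cut k (m+n≤o⇒n≤o (size A₁) le) D₂ σ ρ inc E (swap _ _ ↭-refl)) (shift _ (map (subJ σ ρ) Δb) Δ))
           (↭-trans (↭-reflexive (sym (List.++-assoc (map (subJ σ ρ) Δa) _ Δ)))
                    (++⁺ʳ Δ (↭-sym (map⁺-++ (subJ σ ρ) {ys = Δa} {zs = Δb} q))))
    principal k le 𝟏R _ σ ρ inc (𝟏ₚ E) = E
    principal (suc k) {Δ₁ = Δ₁} (s≤s le) (⊸R {A = A₁} D) _ σ ρ inc (⊸ₚ {Δ₁ = Δa} E₁ E₂) =
      exch (plainCut k (size-subP≤ σ ρ A₁ (m+n≤o⇒m≤o (size A₁) le)) E₁
                     (cut k (m+n≤o⇒n≤o (size A₁) le) D σ ρ inc E₂ ↭-refl) ↭-refl)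
           (shifts Δa (map (subJ σ ρ) Δ₁))
    principal (suc k) (s≤s le) (&R {A = A₁} D₁ D₂) _ σ ρ inc (&₁ₚ E) = cut k (m+n≤o⇒m≤o (size A₁) le) D₁ σ ρ inc E ↭-refl
    principal (suc k) (s≤s le) (&R {A = A₁} D₁ D₂) _ σ ρ inc (&₂ₚ E) = cut k (m+n≤o⇒n≤o (size A₁) le) D₂ σ ρ inc E ↭-refl
    principal (suc k) (s≤s le) (⊕R₁ {A = A₁} D) _ σ ρ inc (⊕ₚ E₁ E₂) = cut k (m+n≤o⇒m≤o (size A₁) le) D σ ρ inc E₁ ↭-refl
    principal (suc k) (s≤s le) (⊕R₂ {A = A₁} D) _ σ ρ inc (⊕ₚ E₁ E₂) = cut k (m+n≤o⇒n≤o (size A₁) le) D σ ρ inc E₂ ↭-refl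
    principal (suc k) {Δ₁ = Δ₁} (s≤s le) (∀ᵗR {A = A₁} D) _ σ ρ inc {Δ} (∀ᵗₚ t E) =
      exch (cut k le D (t ▹ᵗ σ) ρ (⊆-mapˡ (▹ᵗ-wkJᵗ σ ρ t) inc) E (head≡ ([/ᵗ]-liftT σ ρ t A₁)))
           (++⁺ʳ Δ (↭-reflexive (sym (map-triangle (λ x → sym (▹ᵗ-wkJᵗ σ ρ t x)) Δ₁))))
    principal (suc k) {Δ₁ = Δ₁} {u = u} (s≤s le) (∀ʷR {A = A₁} D) _ σ ρ inc {Δ} (∀ʷₚ v E) =
      exch (cut k le D σ (v ▹ʷ ρ) (⊆-mapˡ (▹ʷ-wkJʷ σ ρ v) inc) E
                (↭-reflexive (cong (_∷ Δ) (cong₂ _＠_ ([/ʷ]-liftW σ ρ v A₁) (sym (subW-∘ _ _ u))))))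
           (++⁺ʳ Δ (↭-reflexive (sym (map-triangle (λ x → sym (▹ʷ-wkJʷ σ ρ v x)) Δ₁))))
    principal (suc k) (s≤s le) (∃ᵗR {A = A₁} t D) _ σ ρ inc {Δ} (∃ᵗₚ E) =
      cut k (size-subP≤ _ _ A₁ le) D σ ρ inc (instantiateᵗ (subT σ t) E)
          (↭-reflexive (cong (_∷ Δ) (cong₂ _＠_ (sym (subP-[/ᵗ] σ ρ t A₁)) (subW-id _))))
    principal (suc k) {u = u} (s≤s le) (∃ʷR {A = A₁} v D) _ σ ρ inc {Δ} (∃ʷₚ E) =
      cut k (size-subP≤ _ _ A₁ le) D σ ρ inc (instantiateʷ (subW ρ v) E)
          (↭-reflexive (cong (_∷ Δ) (cong₂ _＠_ (sym (subP-[/ʷ] σ ρ v A₁)) (▹ʷ-wkW (subW ρ v) (subW ρ u)))))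
    principal (suc k) (s≤s le) (!R D) _ σ ρ inc (!ₚ E) = cut! k le D σ ρ inc E id
    principal (suc k) (s≤s le) (atR D) _ σ ρ inc (atₚ E) = cut k le D σ ρ inc E ↭-refl
    principal (suc k) {u = u} (s≤s le) (↓R {A = A₁} D) _ σ ρ inc (↓ₚ E) =
      cut k (size-subP≤ _ _ A₁ le) D σ ρ inc E (head≡ (sym (subP-[/ʷ] σ ρ u A₁)))

    plainCut : ∀ k {n m} {Γ Δ₁ : Ctx n m} {A : Prop n m} {u : World m} → size A ≤ k → Γ ⨾ Δ₁ ⟹ A ＠ u
             → ∀ {Δ Δ₂ J} → Γ ⨾ Δ ⟹ J → Δ ↭ (A ＠ u) ∷ Δ₂ → Γ ⨾ Δ₁ ++ Δ₂ ⟹ J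
    plainCut k {Δ₁ = Δ₁} le D {Δ₂ = Δ₂} E p =
      exch (cut k le D var wvar (⊆-subJ-id id) E (↭-trans p (↭-reflexive (cong (_∷ Δ₂) (sym (subJ-id _))))))
           (++⁺ʳ Δ₂ (↭-reflexive (map-subJ-id Δ₁)))

    -- Cut into an unrestricted hypothesis: D proves it from no linear
    -- hypotheses, and every use of it by copy is replaced by a linear cut.
    cut! : ∀ k {n m n' m'} {Γ : Ctx n m} {A : Prop n m} {u : World m} → size A ≤ k → (D : Γ ⨾ [] ⟹ A ＠ u)
         → (σ : Fin n → Term n') (ρ : Fin m → World m') {Γ' : Ctx n' m'} → Γ ⊆[ subJ σ ρ ] Γ'
         → ∀ {Γₑ Δ J} → Γₑ ⨾ Δ ⟹ J → Γₑ ⊆[ id ] (subJ σ ρ (A ＠ u) ∷ Γ') → Γ' ⨾ Δ ⟹ J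
    cut! k le D σ ρ inc init iE = init
    cut! k le D σ ρ inc {Δ = Δ} (copy x E) iE with iE x
    ... | here e    = cut k le D σ ρ inc (cut! k le D σ ρ inc E iE) (↭-reflexive (cong (_∷ Δ) e))
    ... | there x'  = copy x' (cut! k le D σ ρ inc E iE)
    cut! k le D σ ρ inc (⊗R E₁ E₂ q) iE = ⊗R (cut! k le D σ ρ inc E₁ iE) (cut! k le D σ ρ inc E₂ iE) q
    cut! k le D σ ρ inc (⊗L E q) iE     = ⊗L (cut! k le D σ ρ inc E iE) q
    cut! k le D σ ρ inc 𝟏R iE           = 𝟏R
    cut! k le D σ ρ inc (𝟏L E q) iE     = 𝟏L (cut! k le D σ ρ inc E iE) q
    cut! k le D σ ρ inc (⊸R E) iE       = ⊸R (cut! k le D σ ρ inc E iE)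
    cut! k le D σ ρ inc (⊸L E₁ E₂ q) iE = ⊸L (cut! k le D σ ρ inc E₁ iE) (cut! k le D σ ρ inc E₂ iE) q
    cut! k le D σ ρ inc ⊤R iE           = ⊤R
    cut! k le D σ ρ inc (&R E₁ E₂) iE   = &R (cut! k le D σ ρ inc E₁ iE) (cut! k le D σ ρ inc E₂ iE)
    cut! k le D σ ρ inc (&L₁ E q) iE    = &L₁ (cut! k le D σ ρ inc E iE) q
    cut! k le D σ ρ inc (&L₂ E q) iE    = &L₂ (cut! k le D σ ρ inc E iE) q
    cut! k le D σ ρ inc (⊕R₁ E) iE      = ⊕R₁ (cut! k le D σ ρ inc E iE)
    cut! k le D σ ρ inc (⊕R₂ E) iE      = ⊕R₂ (cut! k le D σ ρ inc E iE)
    cut! k le D σ ρ inc (⊕L E₁ E₂ q) iE = ⊕L (cut! k le D σ ρ inc E₁ iE) (cut! k le D σ ρ inc E₂ iE) q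
    cut! k le D σ ρ inc (𝟎L q) iE       = 𝟎L q
    cut! k {A = A} {u = u} le D σ ρ inc (∀ᵗR E) iE =
      ∀ᵗR (cut! k le D (wkT ∘ σ) ρ (⊆-mapʳ (wkJᵗ-subJ′ σ ρ) inc) E (⊆-map-∷ (wkJᵗ-subJ′ σ ρ (A ＠ u)) iE))
    cut! k {A = A} {u = u} le D σ ρ inc (∀ʷR E) iE =
      ∀ʷR (cut! k le D σ (wkW ∘ ρ) (⊆-mapʳ (wkJʷ-subJ′ σ ρ) inc) E (⊆-map-∷ (wkJʷ-subJ′ σ ρ (A ＠ u)) iE))
    cut! k le D σ ρ inc (∀ᵗL t E q) iE  = ∀ᵗL t (cut! k le D σ ρ inc E iE) q
    cut! k le D σ ρ inc (∀ʷL v E q) iE  = ∀ʷL v (cut! k le D σ ρ inc E iE) q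
    cut! k le D σ ρ inc (∃ᵗR t E) iE    = ∃ᵗR t (cut! k le D σ ρ inc E iE)
    cut! k le D σ ρ inc (∃ʷR v E) iE    = ∃ʷR v (cut! k le D σ ρ inc E iE)
    cut! k {A = A} {u = u} le D σ ρ inc (∃ᵗL E q) iE =
      ∃ᵗL (cut! k le D (wkT ∘ σ) ρ (⊆-mapʳ (wkJᵗ-subJ′ σ ρ) inc) E (⊆-map-∷ (wkJᵗ-subJ′ σ ρ (A ＠ u)) iE)) q
    cut! k {A = A} {u = u} le D σ ρ inc (∃ʷL E q) iE =
      ∃ʷL (cut! k le D σ (wkW ∘ ρ) (⊆-mapʳ (wkJʷ-subJ′ σ ρ) inc) E (⊆-map-∷ (wkJʷ-subJ′ σ ρ (A ＠ u)) iE)) q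
    cut! k le D σ ρ inc (!R E) iE       = !R (cut! k le D σ ρ inc E iE)
    cut! k le D σ ρ inc (!L E q) iE     = !L (cut! k le D σ ρ (there ∘ inc) E (⊆-∷-skip iE)) q
    cut! k le D σ ρ inc (atR E) iE      = atR (cut! k le D σ ρ inc E iE)
    cut! k le D σ ρ inc (atL E q) iE    = atL (cut! k le D σ ρ inc E iE) q
    cut! k le D σ ρ inc (↓R E) iE       = ↓R (cut! k le D σ ρ inc E iE)
    cut! k le D σ ρ inc (↓L E q) iE     = ↓L (cut! k le D σ ρ inc E iE) q

  cut-admissible : ∀ {n m} {Γ Δ₁ Δ Δ₂ : Ctx n m} {A u J}
                 → Γ ⨾ Δ₁ ⟹ A ＠ u → Γ ⨾ Δ ⟹ J → Δ ↭ (A ＠ u) ∷ Δ₂ → Γ ⨾ Δ₁ ++ Δ₂ ⟹ J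
  cut-admissible {A = A} D E p = plainCut (size A) ≤-refl D E p

  elim : ∀ {n m} {Γ Δ Δ₁ Δ₂ : Ctx n m} {X J} → Γ ⨾ Δ₁ ⟹ X → Γ ⨾ X ∷ Δ₂ ⟹ J → Δ ↭ Δ₁ ++ Δ₂ → Γ ⨾ Δ ⟹ J
  elim {X = A ＠ u} D E q = exch (cut-admissible D E ↭-refl) (↭-sym q)

  elim₁ : ∀ {n m} {Γ Δ : Ctx n m} {X J} → Γ ⨾ Δ ⟹ X → Γ ⨾ [ X ] ⟹ J → Γ ⨾ Δ ⟹ J
  elim₁ {Δ = Δ} D E = elim D E (↭-reflexive (sym (List.++-identityʳ Δ)))

  completeness : ∀ {n m} {Γ Δ : Ctx n m} {J} → Γ ⨾ Δ ⊢ J → Γ ⨾ Δ ⟹ J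
  completeness (hyp {J = A ＠ w})    = identity A w
  completeness (hyp! {J = A ＠ w} x) = copy x (identity A w)
  completeness (⊗I D₁ D₂ q)          = ⊗R (completeness D₁) (completeness D₂) q
  completeness 𝟏I                    = 𝟏R
  completeness (⊸I D)                = ⊸R (completeness D)
  completeness (&I D₁ D₂)            = &R (completeness D₁) (completeness D₂)
  completeness ⊤I                    = ⊤R
  completeness (⊕I₁ D)               = ⊕R₁ (completeness D)
  completeness (⊕I₂ D)               = ⊕R₂ (completeness D)
  completeness (∀ᵗI D)               = ∀ᵗR (completeness D)
  completeness (∀ʷI D)               = ∀ʷR (completeness D)
  completeness (∃ᵗI t D)             = ∃ᵗR t (completeness D)
  completeness (∃ʷI v D)             = ∃ʷR v (completeness D)
  completeness (!I D)                = !R (completeness D)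
  completeness (atI D)               = atR (completeness D)
  completeness (↓I D)                = ↓R (completeness D)
  completeness (⊗E D₁ D₂ q)          = elim (completeness D₁) (⊗L (completeness D₂) ↭-refl) q
  completeness (𝟏E D₁ D₂ q)          = elim (completeness D₁) (𝟏L (completeness D₂) ↭-refl) q
  completeness (⊸E {B = B} {w = w} {Δ₂ = Δ₂} D₁ D₂ q) =
    elim (completeness D₁) (⊸L (completeness D₂) (identity B w) (↭-reflexive (cong (_ ∷_) (sym (List.++-identityʳ Δ₂))))) q
  completeness (&E₁ {A = A} {w = w} D) = elim₁ (completeness D) (&L₁ (identity A w) ↭-refl)
  completeness (&E₂ {B = B} {w = w} D) = elim₁ (completeness D) (&L₂ (identity B w) ↭-refl)
  completeness (⊕E D₁ D₂ D₃ q)       = elim (completeness D₁) (⊕L (completeness D₂) (completeness D₃) ↭-refl) q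
  completeness (𝟎E D q)              = elim (completeness D) (𝟎L ↭-refl) q
  completeness (∀ᵗE {w = w} {A = A} t D) = elim₁ (completeness D) (∀ᵗL t (identity ([ t /ᵗ] A) w) ↭-refl)
  completeness (∀ʷE {w = w} {A = A} v D) = elim₁ (completeness D) (∀ʷL v (identity ([ v /ʷ] A) w) ↭-refl)
  completeness (∃ᵗE D₁ D₂ q)         = elim (completeness D₁) (∃ᵗL (completeness D₂) ↭-refl) q
  completeness (∃ʷE D₁ D₂ q)         = elim (completeness D₁) (∃ʷL (completeness D₂) ↭-refl) q
  completeness (!E D₁ D₂ q)          = elim (completeness D₁) (!L (completeness D₂) ↭-refl) q
  completeness (atE {A = A} {w = w} D) = elim₁ (completeness D) (atL (identity A w) ↭-refl)
  completeness (↓E {w = w} {A = A} D)  = elim₁ (completeness D) (↓L (identity ([ w /ʷ] A) w) ↭-refl)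

mainTheorem7 : ∀ {c ℓ} (S : Signature) (𝒲 : Monoid c ℓ) →
    let open HyLL S 𝒲 in
    ∀ {n m : ℕ} (Γ Δ : Ctx n m) (C : Prop n m) (w : World m) →
      ((Γ ⨾ Δ ⟹ C ＠ w) → (Γ ⨾ Δ ⊢ C ＠ w))
      × ((Γ ⨾ Δ ⊢ C ＠ w) → (Γ ⨾ Δ ⟹ C ＠ w))
mainTheorem7 S 𝒲 Γ Δ C w = soundness , completeness
  where open Metatheory S 𝒲
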